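{- Let $n\geq t\geq 2$ be integers with $n\equiv t\pmod 2$. A permutation $\pi=\pi_1\cdots\pi_n\in S_n$ is $t$-sorted and has exactly $\frac{n-t}{2}$ descents if and only if its left-to-right maxima are exactly the entries $\pi_1,\pi_3,\pi_5,\ldots,\pi_{n-t+1},\pi_{n-t+2},\pi_{n-t+3},\ldots,\pi_n$. In particular, the number of such permutations in $S_n$ is $(n-t-1)!!$.
   Context: A permutation is a permutation of a finite set of positive integers written in one-line notation; $S_n$ is the set of permutations of $[n]=\{1,\dots,n\}$. West's stack-sorting map $s$ is defined as follows: given an input permutation $\pi=\pi_1\cdots\pi_n$, process it with an initially empty vertical stack; at each step, if the stack is empty or the next entry of the input is smaller than the entry at the top of the stack, push the next input entry onto the stack; otherwise pop the top entry of the stack and append it to the end of the output. When the output has length $n$, this output is $s(\pi)$. $s^t$ denotes the $t$-fold composition of $s$. A permutation is $t$-sorted if it equals $s^t(\mu)$ for some permutation $\mu$. A descent of $\pi$ is an index $i\in[n-1]$ with $\pi_i>\pi_{i+1}$. A left-to-right maximum of $\pi$ is an entry $\pi_j$ that is larger than every entry $\pi_i$ with $i<j$. For odd $m$, $m!!=m(m-2)(m-4)\cdots 1$, and $(-1)!!=1$. -}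

module Defs where

open import Data.Nat using (ℕ; zero; suc; _+_; _*_; _∸_; _≤_; _<_; _<ᵇ_)
open import Data.Nat.DivMod using (_/_; _%_)
open import Data.Bool using (if_then_else_)
open import Data.Fin using (Fin; toℕ)
open import Data.List using (List; []; _∷_; _++_; [_]; length; lookup; map; upTo)
open import Data.List.Relation.Unary.All using (All)
open import Data.List.Relation.Unary.Unique.Propositional using (Unique)
open import Data.List.Relation.Binary.Permutation.Propositional using (_↭_)
open import Data.Product using (_×_; ∃-syntax)
open import Data.Sum using (_⊎_)
open import Function using (_∘_)
open import Relation.Binary.PropositionalEquality using (_≡_)

range : ℕ → List ℕ
range n = map suc (upTo n)

-- π ∈ S_n : π is a rearrangement of 1 … n (one-line notation)
IsPerm : ℕ → List ℕ → Set
IsPerm n π = π ↭ range n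

-- a permutation of some finite set of positive integers
IsPermutation : List ℕ → Set
IsPermutation μ = Unique μ × All (λ x → 1 ≤ x) μ

-- West's stack-sorting algorithm.
-- run input stack output : stack is a list with its top at the head.
run : List ℕ → List ℕ → List ℕ → List ℕ
run [] [] out = out
run [] (y ∷ st) out = run [] st (out ++ [ y ])
run (x ∷ xs) [] out = run xs [ x ] out
run (x ∷ xs) (y ∷ st) out =
  if x <ᵇ y then run xs (x ∷ y ∷ st) out
            else run (x ∷ xs) st (out ++ [ y ])

s : List ℕ → List ℕ
s π = run π [] []

s^ : ℕ → List ℕ → List ℕ
s^ zero π = π
s^ (suc t) π = s (s^ t π)

TSorted : ℕ → List ℕ → Set
TSorted t π = ∃[ μ ] (IsPermutation μ × s^ t μ ≡ π)

des : List ℕ → ℕ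
des [] = 0
des (x ∷ []) = 0
des (x ∷ y ∷ xs) = (if y <ᵇ x then 1 else 0) + des (y ∷ xs)

-- the entry at (0-based) position i is a left-to-right maximum
IsLTRMax : (π : List ℕ) → Fin (length π) → Set
IsLTRMax π i = ∀ (j : Fin (length π)) → toℕ j < toℕ i → lookup π j < lookup π i

-- the 1-based position k lies in {1,3,5,…,n-t+1} ∪ {n-t+2,…,n}
InPattern : ℕ → ℕ → ℕ → Set
InPattern n t k = ((∃[ m ] k ≡ 1 + 2 * m) × k ≤ n ∸ t + 1) ⊎ (n ∸ t + 2 ≤ k × k ≤ n)

LTRPattern : ℕ → ℕ → List ℕ → Set
LTRPattern n t π = ∀ (i : Fin (length π)) →
  (IsLTRMax π i → InPattern n t (suc (toℕ i))) × (InPattern n t (suc (toℕ i)) → IsLTRMax π i)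

_!! : ℕ → ℕ
zero !! = 1
suc zero !! = 1
suc (suc m) !! = suc (suc m) * (m !!)

module Submission where

-- Central notion: a *shape* π = ρ τ, where ρ = a₁ b₁ … a_K b_K is alternating (bᵢ < aᵢ, each aᵢ a
-- new maximum), |ρ| = n − t = 2K, and τ is an increasing run above ρ (a "rising tail").
-- (1) t-sorted with K descents ⇒ shape.  After t − 2 passes the top t − 2 entries form a rising
--     tail (`top-fixed-after-passes`), so the last two passes act on the rest ν alone.  Splitting at
--     the maximum gives 2·des(s ν) ≤ |ν| − 1 (`one-pass-bound`) and 2·des(s² ν) ≤ |ν| − 2, with
--     equality only for "alternating, then c₁ < c₂" (`two-pass-bound`); see `shape-of-extremal`.
-- (2) shape ⇒ t-sorted with K descents: holding back the first t peaks of the interleaving of peaks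
--     and valleys gives an explicit preimage (`s^-delay`, `extremal-of-shape`).
-- (3) Reading a shape from the left yields exactly the stated left-to-right maxima (`shape⟺pattern`).
-- (4) The shapes in S_n are the alternating permutations of [2K] followed by n − t + 1, …, n
--     (`rising-tail-is-top`); those are built by appending a last pair (2K, b), so there are
--     (2K − 1)!! of them (`alternating-perms-length`).  `theorem3` assembles (1)–(4).

open import Defs
open import Data.Nat
open import Data.Nat.Properties
open import Data.Nat.Tactic.RingSolver using (solve-∀)
open import Data.Nat.DivMod using (_/_; _%_; %-distribˡ-+; m%n<n; m*[n/m]≡n)
open import Data.Nat.Divisibility using (m%n≡0⇒n∣m)
open import Data.Bool using (true; false; if_then_else_; T)
open import Data.List using (List; []; _∷_; _++_; [_]; length; map; upTo; drop; lookup; cartesianProductWith)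
open import Data.Fin using (Fin; toℕ) renaming (zero to fzero; suc to fsuc)
open import Data.List.Properties
  using (++-assoc; ++-identityʳ; length-++; ∷ʳ-injective; length-map; length-upTo; map-++; upTo-∷ʳ; map-id-local;
         map-∘; map-cong; map-id; map-injective; ++-cancelʳ)
open import Data.List.Relation.Unary.All as All using (All; []; _∷_)
open import Data.List.Relation.Unary.Any using (here; there)
import Data.List.Relation.Unary.All.Properties as All
open import Data.List.Relation.Unary.AllPairs using (AllPairs; []; _∷_) renaming (map to AllPairs-map)
import Data.List.Relation.Unary.AllPairs.Properties as AllPairs
open import Data.List.Reverse using (Reverse; []; _∶_∶ʳ_; reverseView)
open import Data.List.Relation.Unary.Unique.Propositional using (Unique)
import Data.List.Relation.Unary.Unique.Propositional.Properties as Unique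
open import Data.List.Relation.Binary.Permutation.Propositional
  using (_↭_; prep; swap; ↭-refl; ↭-sym; ↭-trans; ↭-reflexive; ↭⇒↭ₛ)
open import Data.List.Relation.Binary.Permutation.Propositional.Properties
  using (shift; ++⁺; ++⁺ˡ; ++⁺ʳ; ↭-length; All-resp-↭; ∈-resp-↭; drop-mid; ↭-empty-inv) renaming (map⁺ to ↭-map⁺)
import Data.List.Relation.Binary.Permutation.Setoid.Properties as Setoid↭
open import Data.List.Membership.Propositional.Properties
  using (∈-insert; ∈-++⁺ˡ; ∈-++⁺ʳ; ∈-map⁺; ∈-map⁻; ∈-cartesianProductWith⁺; ∈-cartesianProductWith⁻)
open import Data.List.Relation.Binary.Prefix.Heterogeneous using (Prefix; []; _∷_; _++ᵖ_)
open import Data.Product using (Σ; _×_; _,_; proj₁; proj₂; uncurry; ∃-syntax)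
open import Data.Unit using (⊤)
open import Function using (_∘_)
open import Data.Empty using (⊥-elim)
open import Data.Sum using (inj₁; inj₂)
open import Relation.Nullary using (¬_; yes; no)
open import Relation.Binary.Definitions using (tri<; tri≈; tri>)
open import Relation.Binary.PropositionalEquality
  using (_≡_; _≢_; refl; sym; trans; cong; cong₂; subst; subst₂; setoid; module ≡-Reasoning)
open import Data.List.Membership.Propositional using (_∈_)

<ᵇ-true : ∀ {m n} → m < n → (m <ᵇ n) ≡ true
<ᵇ-true {zero}  {suc n} _       = refl
<ᵇ-true {suc m} {suc n} (s≤s p) = <ᵇ-true p

<ᵇ-false : ∀ {m n} → n ≤ m → (m <ᵇ n) ≡ false
<ᵇ-false {m}     {zero}  _       = refl
<ᵇ-false {suc m} {suc n} (s≤s p) = <ᵇ-false p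

if-true : ∀ {A : Set} {b} {x y : A} → b ≡ true → (if b then x else y) ≡ x
if-true refl = refl

if-false : ∀ {A : Set} {b} {x y : A} → b ≡ false → (if b then x else y) ≡ y
if-false refl = refl

if-both : ∀ b {A B : Set} (f : A → B) {x₁ x₂ : B} {y₁ y₂ : A} → x₁ ≡ f y₁ → x₂ ≡ f y₂ →
  (if b then x₁ else x₂) ≡ f (if b then y₁ else y₂)
if-both true  f p q = p
if-both false f p q = q

if-elim : ∀ {A : Set} (P : A → Set) b {x y} → P x → P y → P (if b then x else y)
if-elim P true  px py = px
if-elim P false px py = py

AllPairs-++⁻ : ∀ {R : ℕ → ℕ → Set} xs {ys} → AllPairs R (xs ++ ys) →
  AllPairs R xs × AllPairs R ys × All (λ x → All (R x) ys) xs
AllPairs-++⁻ []       p        = [] , p , []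
AllPairs-++⁻ (x ∷ xs) (px ∷ p) with AllPairs-++⁻ xs p
... | pxs , pys , cross = (All.++⁻ˡ xs px ∷ pxs) , pys , (All.++⁻ʳ xs px ∷ cross)

Unique-resp-↭ : ∀ {xs ys : List ℕ} → xs ↭ ys → Unique xs → Unique ys
Unique-resp-↭ p = Setoid↭.Unique-resp-↭ (setoid ℕ) (↭⇒↭ₛ p)

Unique-drop-mid : ∀ X {M : ℕ} Y → Unique (X ++ M ∷ Y) → Unique (X ++ Y)
Unique-drop-mid X Y u with AllPairs-++⁻ X u
... | uX , (_ ∷ uY) , cross = AllPairs.++⁺ uX uY (All.map All.tail cross)

Unique-++⁻ : ∀ xs {ys : List ℕ} → Unique (xs ++ ys) → Unique xs × Unique ys
Unique-++⁻ xs u with AllPairs-++⁻ xs u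
... | uxs , uys , _ = uxs , uys

Unique-halves : ∀ X {M : ℕ} Y → Unique (X ++ M ∷ Y) → Unique X × Unique Y
Unique-halves X Y u with Unique-++⁻ X u
... | uX , (_ ∷ uY) = uX , uY

All<-lift : ∀ {X Y : List ℕ} {M N} → All (_< M) X → All (_< M) Y → M < N → All (_< N) (X ++ M ∷ Y)
All<-lift pX pY M<N = All.++⁺ (All.map (λ p → <-trans p M<N) pX) (M<N ∷ All.map (λ p → <-trans p M<N) pY)

record MaxSplit (w : List ℕ) : Set where
  constructor max-split
  field
    left : List ℕ
    max : ℕ
    right : List ℕ
    split : w ≡ left ++ max ∷ right
    left<max : All (_< max) left
    right<max : All (_< max) right

maxSplit : ∀ x w → Unique (x ∷ w) → MaxSplit (x ∷ w)
maxSplit x []      _        = max-split [] x [] refl [] []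
maxSplit x (y ∷ w) (px ∷ u) with maxSplit y w u
... | max-split X M Y eq pX pY with <-cmp x M
... | tri< x<M _ _ = max-split (x ∷ X) M Y (cong (x ∷_) eq) (x<M ∷ pX) pY
... | tri≈ _ x≡M _ = ⊥-elim (All.lookup px (subst (M ∈_) (sym eq) (∈-insert X)) x≡M)
... | tri> _ _ M<x = max-split [] x (X ++ M ∷ Y) (cong (x ∷_) eq) [] (All<-lift pX pY M<x)

-- `run` only ever appends to its output: a prefix of the output is carried along unchanged.
run-prefix : ∀ xs st out o → run xs st (out ++ o) ≡ out ++ run xs st o
run-prefix []       []       out o = refl
run-prefix []       (y ∷ st) out o =
  trans (cong (run [] st) (++-assoc out o [ y ])) (run-prefix [] st out (o ++ [ y ]))
run-prefix (x ∷ xs) []       out o = run-prefix xs [ x ] out o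
run-prefix (x ∷ xs) (y ∷ st) out o = if-both (x <ᵇ y) (out ++_)
  (run-prefix xs (x ∷ y ∷ st) out o)
  (trans (cong (run (x ∷ xs) st) (++-assoc out o [ y ])) (run-prefix (x ∷ xs) st out (o ++ [ y ])))

run-output : ∀ xs st out → run xs st out ≡ out ++ run xs st []
run-output xs st out = trans (cong (run xs st) (sym (++-identityʳ out))) (run-prefix xs st out [])

run-↭ : ∀ xs st out → run xs st out ↭ out ++ st ++ xs
run-↭ []       []       out = ↭-reflexive (sym (++-identityʳ out))
run-↭ []       (y ∷ st) out = ↭-trans (run-↭ [] st (out ++ [ y ])) (↭-reflexive (++-assoc out [ y ] _))
run-↭ (x ∷ xs) []       out = run-↭ xs [ x ] out
run-↭ (x ∷ xs) (y ∷ st) out = if-elim (_↭ out ++ (y ∷ st) ++ x ∷ xs) (x <ᵇ y)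
  (↭-trans (run-↭ xs (x ∷ y ∷ st) out)
    (++⁺ˡ out (↭-trans (swap x y ↭-refl) (prep y (↭-sym (shift x st xs))))))
  (↭-trans (run-↭ (x ∷ xs) st (out ++ [ y ])) (↭-reflexive (++-assoc out [ y ] _)))

s-↭ : ∀ w → s w ↭ w
s-↭ w = run-↭ w [] []

s-length : ∀ w → length (s w) ≡ length w
s-length w = ↭-length (s-↭ w)

All-s : ∀ {P : ℕ → Set} {w} → All P w → All P (s w)
All-s {w = w} = All-resp-↭ (↭-sym (s-↭ w))

s^-↭ : ∀ j w → s^ j w ↭ w
s^-↭ zero    w = ↭-refl
s^-↭ (suc j) w = ↭-trans (s-↭ (s^ j w)) (s^-↭ j w)

s^-suc : ∀ j w → s^ (suc j) w ≡ s^ j (s w)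
s^-suc zero    w = refl
s^-suc (suc j) w = cong s (s^-suc j w)

-- Feeding `X ++ M ∷ Y` with `M` above `X` and the stack: `X` is processed, then `M` clears
-- the stack and sits at the bottom while `Y` is processed.
run-through-max : ∀ {M} X Y st out → All (_< M) X → All (_< M) st →
  run (X ++ M ∷ Y) st out ≡ run Y [ M ] (run X st out)
run-through-max []      Y []       out _ _ = refl
run-through-max {M} []  Y (y ∷ st) out _ (y<M ∷ st<M) =
  trans (if-false (<ᵇ-false (<⇒≤ y<M))) (run-through-max [] Y st (out ++ [ y ]) [] st<M)
run-through-max (x ∷ X) Y []       out (x<M ∷ X<M) _ = run-through-max X Y [ x ] out X<M (x<M ∷ [])
run-through-max (x ∷ X) Y (y ∷ st) out (x<M ∷ X<M) (y<M ∷ st<M) =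
  if-both (x <ᵇ y) (run Y [ _ ])
    (run-through-max X Y (x ∷ y ∷ st) out X<M (x<M ∷ y<M ∷ st<M))
    (run-through-max (x ∷ X) Y st (out ++ [ y ]) (x<M ∷ X<M) st<M)

run-bottom : ∀ {M} Y st out → All (_< M) Y → run Y (st ++ [ M ]) out ≡ run Y st out ++ [ M ]
run-bottom []      []       out _ = refl
run-bottom []      (z ∷ st) out _ = run-bottom [] st (out ++ [ z ]) []
run-bottom (y ∷ Y) []       out (y<M ∷ Y<M) = trans (if-true (<ᵇ-true y<M)) (run-bottom Y [ y ] out Y<M)
run-bottom (y ∷ Y) (z ∷ st) out (y<M ∷ Y<M) =
  if-both (y <ᵇ z) (_++ [ _ ]) (run-bottom Y (y ∷ z ∷ st) out Y<M) (run-bottom (y ∷ Y) st (out ++ [ z ]) (y<M ∷ Y<M))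

s-max : ∀ X {M} Y → All (_< M) X → All (_< M) Y → s (X ++ M ∷ Y) ≡ (s X ++ s Y) ++ [ M ]
s-max X {M} Y X<M Y<M = begin
  run (X ++ M ∷ Y) [] []   ≡⟨ run-through-max X Y [] [] X<M [] ⟩
  run Y [ M ] (s X)        ≡⟨ run-bottom Y [] (s X) Y<M ⟩
  run Y [] (s X) ++ [ M ]  ≡⟨ cong (_++ [ M ]) (run-output Y [] (s X)) ⟩
  (s X ++ s Y) ++ [ M ]    ∎
  where open ≡-Reasoning

RisingTail : List ℕ → List ℕ → Set
RisingTail ν D = AllPairs _<_ D × All (λ d → All (_< d) ν) D

run-increasing : ∀ y zs out → AllPairs _<_ (y ∷ zs) → run zs [ y ] out ≡ out ++ y ∷ zs
run-increasing y []       out _ = refl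
run-increasing y (z ∷ zs) out ((y<z ∷ _) ∷ inc) =
  trans (if-false (<ᵇ-false (<⇒≤ y<z))) (trans (run-increasing z zs (out ++ [ y ]) inc) (++-assoc out [ y ] (z ∷ zs)))

s-rising-tail : ∀ ν D → RisingTail ν D → s (ν ++ D) ≡ s ν ++ D
s-rising-tail ν []      _ = trans (cong s (++-identityʳ ν)) (sym (++-identityʳ (s ν)))
s-rising-tail ν (d ∷ D) (inc , (ν<d ∷ _)) = trans (run-through-max ν D [] [] ν<d []) (run-increasing d D (s ν) inc)

RisingTail-↭ : ∀ {ν ν' D} → ν' ↭ ν → RisingTail ν D → RisingTail ν' D
RisingTail-↭ p (inc , above) = inc , All.map (All-resp-↭ (↭-sym p)) above

s-pair-↭ : ∀ X Y → s X ++ s Y ↭ X ++ Y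
s-pair-↭ X Y = ++⁺ (s-↭ X) (s-↭ Y)

All-drop-mid : ∀ {P : ℕ → Set} X {M} Y → All P (X ++ M ∷ Y) → All P (X ++ Y)
All-drop-mid X Y p with All.++⁻ X p
... | pX , (_ ∷ pY) = All.++⁺ pX pY

length-mid : ∀ X (M : ℕ) Y → length (X ++ M ∷ Y) ≡ suc (length X + length Y)
length-mid X M Y = trans (length-++ X) (+-suc (length X) (length Y))

pass-step : ∀ X M Y D → All (_< M) X → All (_< M) Y → RisingTail (X ++ M ∷ Y) D →
  s ((X ++ M ∷ Y) ++ D) ≡ (s X ++ s Y) ++ M ∷ D × RisingTail (s X ++ s Y) (M ∷ D)
pass-step X M Y D X<M Y<M rising@(inc , above) = equation , (M<D ∷ inc) , (front<M ∷ front<D)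
  where
  equation : s ((X ++ M ∷ Y) ++ D) ≡ (s X ++ s Y) ++ M ∷ D
  equation = begin
    s ((X ++ M ∷ Y) ++ D)        ≡⟨ s-rising-tail (X ++ M ∷ Y) D rising ⟩
    s (X ++ M ∷ Y) ++ D          ≡⟨ cong (_++ D) (s-max X Y X<M Y<M) ⟩
    ((s X ++ s Y) ++ [ M ]) ++ D ≡⟨ ++-assoc (s X ++ s Y) [ M ] D ⟩
    (s X ++ s Y) ++ M ∷ D        ∎
    where open ≡-Reasoning
  M<D : All (M <_) D
  M<D = All.map (λ d-above → All.lookup d-above (∈-insert X)) above
  front<M : All (_< M) (s X ++ s Y)
  front<M = All-resp-↭ (↭-sym (s-pair-↭ X Y)) (All.++⁺ X<M Y<M)
  front<D : All (λ d → All (_< d) (s X ++ s Y)) D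
  front<D = All.map (λ d-above → All-resp-↭ (↭-sym (s-pair-↭ X Y)) (All-drop-mid X Y d-above)) above

record TopFixed (j : ℕ) (μ : List ℕ) : Set where
  constructor top-fixed
  field
    front tail : List ℕ
    split : s^ j μ ≡ front ++ tail
    front-length : length front + j ≡ length μ
    rising : RisingTail front tail

-- Induction on j: each pass moves the largest entry of the front onto the tail (`pass-step`).
top-fixed-after-passes : ∀ j μ → j ≤ length μ → Unique μ → TopFixed j μ
top-fixed-after-passes zero    μ _ _ = top-fixed μ [] (sym (++-identityʳ μ)) (+-identityʳ _) ([] , [])
top-fixed-after-passes (suc j) μ j<|μ| uμ with top-fixed-after-passes j μ (<⇒≤ j<|μ|) uμ
... | top-fixed [] D eq len rising = ⊥-elim (<-irrefl len j<|μ|)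
... | top-fixed (x ∷ ν) D eq len rising
  with maxSplit x ν (proj₁ (Unique-++⁻ (x ∷ ν) (subst Unique eq (Unique-resp-↭ (↭-sym (s^-↭ j μ)) uμ))))
... | max-split X M Y eq' X<M Y<M with pass-step X M Y D X<M Y<M (subst (λ ν' → RisingTail ν' D) eq' rising)
... | equation , rising' =
  top-fixed (s X ++ s Y) (M ∷ D) (trans (cong s (trans eq (cong (_++ D) eq'))) equation) length-eq rising'
  where
  open ≡-Reasoning
  length-eq : length (s X ++ s Y) + suc j ≡ length μ
  length-eq = begin
    length (s X ++ s Y) + suc j   ≡⟨ +-suc _ j ⟩
    suc (length (s X ++ s Y) + j) ≡⟨ cong (λ l → suc (l + j)) (↭-length (s-pair-↭ X Y)) ⟩
    suc (length (X ++ Y) + j)     ≡⟨ cong (λ l → suc (l + j)) (length-++ X) ⟩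
    suc (length X + length Y) + j ≡⟨ cong (_+ j) (sym (length-mid X M Y)) ⟩
    length (X ++ M ∷ Y) + j       ≡⟨ cong (λ l → length l + j) (sym eq') ⟩
    length (x ∷ ν) + j            ≡⟨ len ⟩
    length μ                      ∎

des-split : ∀ u y v → des (u ++ y ∷ v) ≡ des (u ++ [ y ]) + des (y ∷ v)
des-split []           y v = refl
des-split (x ∷ [])     y v = cong (_+ des (y ∷ v)) (sym (+-identityʳ _))
des-split (x ∷ x' ∷ u) y v =
  trans (cong (_ +_) (des-split (x' ∷ u) y v)) (sym (+-assoc (if x' <ᵇ x then 1 else 0) _ _))

des-snoc-max : ∀ u y → All (_< y) u → des (u ++ [ y ]) ≡ des u
des-snoc-max []           y _ = refl
des-snoc-max (x ∷ [])     y (x<y ∷ _) = cong (_+ 0) (if-false (<ᵇ-false (<⇒≤ x<y)))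
des-snoc-max (x ∷ x' ∷ u) y (_ ∷ u<y) = cong (_ +_) (des-snoc-max (x' ∷ u) y u<y)

des-snoc-≤ : ∀ u y → des (u ++ [ y ]) ≤ suc (des u)
des-snoc-≤ []           y = z≤n
des-snoc-≤ (x ∷ [])     y with y <ᵇ x
... | true  = ≤-refl
... | false = z≤n
des-snoc-≤ (x ∷ x' ∷ u) y =
  ≤-trans (+-monoʳ-≤ (if x' <ᵇ x then 1 else 0) (des-snoc-≤ (x' ∷ u) y)) (≤-reflexive (+-suc _ _))

des-++-≤ : ∀ u v → des (u ++ v) ≤ suc (des u + des v)
des-++-≤ u []      = ≤-trans (≤-reflexive (trans (cong des (++-identityʳ u)) (sym (+-identityʳ _)))) (n≤1+n _)
des-++-≤ u (y ∷ v) = ≤-trans (≤-reflexive (des-split u y v)) (+-monoˡ-≤ (des (y ∷ v)) (des-snoc-≤ u y))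

des-increasing : ∀ D → AllPairs _<_ D → des D ≡ 0
des-increasing []           _ = refl
des-increasing (x ∷ [])     _ = refl
des-increasing (x ∷ x' ∷ D) ((x<x' ∷ _) ∷ inc) =
  trans (cong (_+ des (x' ∷ D)) (if-false (<ᵇ-false (<⇒≤ x<x')))) (des-increasing (x' ∷ D) inc)

des-rising-tail : ∀ u D → RisingTail u D → des (u ++ D) ≡ des u
des-rising-tail u []      _ = cong des (++-identityʳ u)
des-rising-tail u (d ∷ D) (inc , (u<d ∷ _)) = begin
  des (u ++ d ∷ D)               ≡⟨ des-split u d D ⟩
  des (u ++ [ d ]) + des (d ∷ D) ≡⟨ cong₂ _+_ (des-snoc-max u d u<d) (des-increasing (d ∷ D) inc) ⟩
  des u + 0                      ≡⟨ +-identityʳ _ ⟩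
  des u                          ∎
  where open ≡-Reasoning

des-s-max : ∀ X {M} Y → All (_< M) X → All (_< M) Y → des (s (X ++ M ∷ Y)) ≡ des (s X ++ s Y)
des-s-max X {M} Y X<M Y<M = trans (cong des (s-max X Y X<M Y<M))
  (des-snoc-max _ M (All-resp-↭ (↭-sym (s-pair-↭ X Y)) (All.++⁺ X<M Y<M)))

module MaxInduction (P : List ℕ → Set) (P[] : P [])
  (step : ∀ X M Y → All (_< M) X → All (_< M) Y → Unique (X ++ M ∷ Y) → P X → P Y → P (X ++ M ∷ Y)) where

  private
    go : ∀ f w → length w ≤ f → Unique w → P w
    go f       []      _  _ = P[]
    go zero    (x ∷ w) () _
    go (suc f) (x ∷ w) |w|≤ u with maxSplit x w u
    ... | max-split X M Y eq X<M Y<M = subst P (sym eq)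
      (step X M Y X<M Y<M u' (go f X |X|≤f (proj₁ uXY)) (go f Y |Y|≤f (proj₂ uXY)))
      where
      u' : Unique (X ++ M ∷ Y)
      u' = subst Unique eq u
      uXY : Unique X × Unique Y
      uXY = Unique-halves X Y u'
      |XY|≤f : length X + length Y ≤ f
      |XY|≤f = s≤s⁻¹ (subst (_≤ suc f) (trans (cong length eq) (length-mid X M Y)) |w|≤)
      |X|≤f : length X ≤ f
      |X|≤f = ≤-trans (m≤m+n (length X) (length Y)) |XY|≤f
      |Y|≤f : length Y ≤ f
      |Y|≤f = ≤-trans (m≤n+m (length Y) (length X)) |XY|≤f

  max-induction : ∀ w → Unique w → P w
  max-induction w = go (length w) w ≤-refl

junction-bound : ∀ {d a b} dX dY → d ≤ suc (dX + dY) → 2 * dX ≤ a → 2 * dY ≤ b → 2 * d ≤ suc a + suc b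
junction-bound {d} {a} {b} dX dY d≤ hX hY = begin
  2 * d                  ≤⟨ *-monoʳ-≤ 2 d≤ ⟩
  2 * suc (dX + dY)      ≡⟨ regroup dX dY ⟩
  2 + (2 * dX + 2 * dY)  ≤⟨ +-monoʳ-≤ 2 (+-mono-≤ hX hY) ⟩
  2 + (a + b)            ≡⟨ cong suc (sym (+-suc a b)) ⟩
  suc a + suc b          ∎
  where
  open ≤-Reasoning
  regroup : ∀ x y → 2 * suc (x + y) ≡ 2 + (2 * x + 2 * y)
  regroup = solve-∀

one-pass-bound : ∀ w → Unique w → 2 * des (s w) ≤ length w ∸ 1
one-pass-bound = MaxInduction.max-induction (λ w → 2 * des (s w) ≤ length w ∸ 1) z≤n step
  where
  step : ∀ X M Y → All (_< M) X → All (_< M) Y → Unique (X ++ M ∷ Y) →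
    2 * des (s X) ≤ length X ∸ 1 → 2 * des (s Y) ≤ length Y ∸ 1 → 2 * des (s (X ++ M ∷ Y)) ≤ length (X ++ M ∷ Y) ∸ 1
  step X M Y X<M Y<M _ hX hY rewrite des-s-max X Y X<M Y<M | length-mid X M Y = combine X Y hX hY
    where
    combine : ∀ X Y → 2 * des (s X) ≤ length X ∸ 1 → 2 * des (s Y) ≤ length Y ∸ 1 →
      2 * des (s X ++ s Y) ≤ length X + length Y
    combine []      Y  _  hY = ≤-trans hY (m∸n≤m (length Y) 1)
    combine (x ∷ X) [] hX _  rewrite ++-identityʳ (s (x ∷ X)) = ≤-trans hX (≤-trans (n≤1+n _) (m≤m+n _ 0))
    combine (x ∷ X) (y ∷ Y) hX hY =
      junction-bound (des (s (x ∷ X))) (des (s (y ∷ Y))) (des-++-≤ (s (x ∷ X)) (s (y ∷ Y))) hX hY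

data Alternating : List ℕ → Set where
  alt-[]   : Alternating []
  alt-snoc : ∀ {ρ a b} → Alternating ρ → All (_< a) ρ → b < a → Alternating (ρ ++ a ∷ b ∷ [])

record Extremal2 (π : List ℕ) : Set where
  constructor extremal2
  field
    body : List ℕ
    c₁ c₂ : ℕ
    split : π ≡ body ++ c₁ ∷ c₂ ∷ []
    alternating : Alternating body
    body<c₁ : All (_< c₁) body
    c₁<c₂ : c₁ < c₂

TwoPassBound : List ℕ → Set
TwoPassBound ν = (2 * des (s (s ν)) ≤ length ν ∸ 2) × (2 * des (s (s ν)) + 2 ≡ length ν → Extremal2 (s (s ν)))

strict-two-pass : ∀ ν → 2 * des (s (s ν)) + 3 ≤ length ν → TwoPassBound ν
strict-two-pass ν lt = bound , λ eq → ⊥-elim (<⇒≢ (≤-trans (≤-reflexive (sym (+-suc _ 2))) lt) eq)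
  where
  bound : 2 * des (s (s ν)) ≤ length ν ∸ 2
  bound = ≤-trans (≤-reflexive (sym (m+n∸n≡m _ 2))) (∸-monoˡ-≤ 2 (≤-trans (+-monoʳ-≤ _ (n≤1+n 2)) lt))

s-snoc-max : ∀ w {M} → All (_< M) w → s (w ++ [ M ]) ≡ s w ++ [ M ]
s-snoc-max w w<M = trans (s-max w [] w<M []) (cong (_++ [ _ ]) (++-identityʳ (s w)))

s²-max : ∀ L {M} R → All (_< M) L → All (_< M) R → s (s (L ++ M ∷ R)) ≡ s (s L ++ s R) ++ [ M ]
s²-max L R L<M R<M = trans (cong s (s-max L R L<M R<M))
  (s-snoc-max (s L ++ s R) (All-resp-↭ (↭-sym (s-pair-↭ L R)) (All.++⁺ L<M R<M)))

des-s²-max : ∀ L {M} R → All (_< M) L → All (_< M) R → des (s (s (L ++ M ∷ R))) ≡ des (s (s L ++ s R))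
des-s²-max L {M} R L<M R<M = trans (cong des (s²-max L R L<M R<M))
  (des-snoc-max _ M (All-s (All-resp-↭ (↭-sym (s-pair-↭ L R)) (All.++⁺ L<M R<M))))

-- Arithmetic of the one-sided equality case: it can only happen for a single remaining entry.
equality-forces-one : ∀ b d → 2 * d ≤ b ∸ 2 → 2 * d + 2 ≡ suc b → b ≡ 1
equality-forces-one zero          d _ eq = ⊥-elim (1+n≢0 (suc-injective (trans (+-comm 2 (2 * d)) eq)))
equality-forces-one (suc zero)    d _ _  = refl
equality-forces-one (suc (suc b)) d le eq = ⊥-elim (<-irrefl eq (begin-strict
  2 * d + 2   ≤⟨ +-monoˡ-≤ 2 le ⟩
  b + 2       ≡⟨ +-comm b 2 ⟩
  suc (suc b) <⟨ n<1+n _ ⟩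
  suc (suc (suc b)) ∎))
  where open ≤-Reasoning

two-pass-one-sided : ∀ ν Z {M} → All (_< M) Z → s (s ν) ≡ s (s Z) ++ [ M ] →
  length ν ≡ suc (length Z) → TwoPassBound Z → TwoPassBound ν
two-pass-one-sided ν Z {M} Z<M ss-eq len-eq (boundZ , _) = bound ,
  equality Z Z<M ss-eq len-eq (subst (λ d → 2 * d ≤ length Z ∸ 2) (sym d-eq) boundZ)
  where
  d-eq : des (s (s ν)) ≡ des (s (s Z))
  d-eq = trans (cong des ss-eq) (des-snoc-max _ M (All-s (All-s Z<M)))
  bound : 2 * des (s (s ν)) ≤ length ν ∸ 2
  bound = subst₂ (λ d l → 2 * d ≤ l ∸ 2) (sym d-eq) (sym len-eq) (≤-trans boundZ (∸-monoˡ-≤ 2 (n≤1+n (length Z))))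
  equality : ∀ Z → All (_< M) Z → s (s ν) ≡ s (s Z) ++ [ M ] → length ν ≡ suc (length Z) →
    2 * des (s (s ν)) ≤ length Z ∸ 2 → 2 * des (s (s ν)) + 2 ≡ length ν → Extremal2 (s (s ν))
  equality Z Z<M ss-eq len-eq boundZ eq
    with equality-forces-one (length Z) (des (s (s ν))) boundZ (trans eq len-eq)
  equality (z ∷ []) (z<M ∷ []) ss-eq _ _ _ | refl = extremal2 [] z M ss-eq alt-[] [] z<M

one-pass-gap : ∀ w d → 1 ≤ w → 2 * d ≤ w ∸ 1 → 2 * d + 3 ≤ suc (suc w)
one-pass-gap (suc w) d _ le = ≤-trans (+-monoˡ-≤ 3 le) (≤-reflexive (+-comm w 3))

-- If the right part holds the larger half-maximum, two passes reduce to one pass of the rest.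
two-pass-right-max : ∀ L M XR MR YR → All (_< M) L → All (_< M) (XR ++ MR ∷ YR) →
  All (_< MR) L → All (_< MR) XR → All (_< MR) YR → 1 ≤ length L →
  Unique (L ++ M ∷ XR ++ MR ∷ YR) → TwoPassBound (L ++ M ∷ XR ++ MR ∷ YR)
two-pass-right-max L M XR MR YR L<M R<M L<MR XR<MR YR<MR 1≤|L| u =
  strict-two-pass ν (≤-trans (subst (λ d → 2 * d + 3 ≤ _) (sym d-eq) gap) (≤-reflexive (sym |ν|)))
  where
  R ν W : List ℕ
  R = XR ++ MR ∷ YR
  ν = L ++ M ∷ R
  W = s L ++ (s XR ++ s YR)
  W-split : s L ++ s R ≡ W ++ [ MR ]
  W-split = trans (cong (s L ++_) (s-max XR YR XR<MR YR<MR)) (sym (++-assoc (s L) (s XR ++ s YR) [ MR ]))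
  W<MR : All (_< MR) W
  W<MR = All.++⁺ (All-s L<MR) (All-resp-↭ (↭-sym (s-pair-↭ XR YR)) (All.++⁺ XR<MR YR<MR))
  d-eq : des (s (s ν)) ≡ des (s W)
  d-eq = trans (des-s²-max L R L<M R<M)
    (trans (cong (des ∘ s) W-split) (trans (cong des (s-snoc-max W W<MR)) (des-snoc-max (s W) MR (All-s W<MR))))
  uW : Unique W
  uW = proj₁ (Unique-++⁻ W (subst Unique W-split
    (Unique-resp-↭ (↭-sym (s-pair-↭ L R)) (Unique-drop-mid L R u))))
  |ν| : length ν ≡ suc (suc (length W))
  |ν| = begin
    length (L ++ M ∷ R)    ≡⟨ length-mid L M R ⟩
    suc (length L + length R) ≡⟨ cong suc (sym (length-++ L)) ⟩
    suc (length (L ++ R))     ≡⟨ cong suc (sym (↭-length (s-pair-↭ L R))) ⟩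
    suc (length (s L ++ s R)) ≡⟨ cong (suc ∘ length) W-split ⟩
    suc (length (W ++ [ MR ])) ≡⟨ cong suc (trans (length-++ W) (+-comm (length W) 1)) ⟩
    suc (suc (length W))      ∎
    where open ≡-Reasoning
  1≤|W| : 1 ≤ length W
  1≤|W| = ≤-trans 1≤|L| (≤-trans (≤-reflexive (sym (s-length L)))
    (≤-trans (m≤m+n (length (s L)) _) (≤-reflexive (sym (length-++ (s L))))))
  gap : 2 * des (s W) + 3 ≤ suc (suc (length W))
  gap = one-pass-gap (length W) (des (s W)) 1≤|W| (one-pass-bound W uW)

descent-at-end : ∀ u y x → des ((u ++ [ y ]) ++ [ x ]) ≡ suc (des (u ++ [ y ])) → x < y
descent-at-end u y x eq with x <ᵇ y in x<ᵇy | des-split u y [ x ]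
... | true  | _     = <ᵇ⇒< x y (subst T (sym x<ᵇy) _)
... | false | split = ⊥-elim (1+n≢n (sym (trans (sym (+-identityʳ _))
  (trans (sym split) (trans (cong des (sym (++-assoc u [ y ] [ x ]))) eq)))))

-- Equality case of the left-maximum situation, stated for lists alone: if U ML is extremal and
-- appending r creates a descent, then U r ML M is extremal.
extremal-left-max : ∀ U {ML M r} → All (_< ML) U → r < ML → ML < M →
  Extremal2 (U ++ [ ML ]) → des (U ++ [ r ]) ≡ suc (des U) → Extremal2 (((U ++ [ r ]) ++ [ ML ]) ++ [ M ])
extremal-left-max U {ML} {M} {r} U<ML r<ML ML<M (extremal2 ρ c₁ c₂ eq alt ρ<c₁ _) descent =
  extremal2 (ρ ++ c₁ ∷ r ∷ []) ML M split (alt-snoc alt ρ<c₁ r<c₁) body<ML ML<M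
  where
  U≡ρc₁ : U ≡ ρ ++ [ c₁ ]
  U≡ρc₁ = proj₁ (∷ʳ-injective U (ρ ++ [ c₁ ]) (trans eq (sym (++-assoc ρ [ c₁ ] [ c₂ ]))))
  r<c₁ : r < c₁
  r<c₁ = descent-at-end ρ c₁ r (subst (λ V → des (V ++ [ r ]) ≡ suc (des V)) U≡ρc₁ descent)
  ρc₁r≡ : (U ++ [ r ]) ≡ ρ ++ c₁ ∷ r ∷ []
  ρc₁r≡ = trans (cong (_++ [ r ]) U≡ρc₁) (++-assoc ρ [ c₁ ] [ r ])
  split : ((U ++ [ r ]) ++ [ ML ]) ++ [ M ] ≡ (ρ ++ c₁ ∷ r ∷ []) ++ ML ∷ M ∷ []
  split = trans (cong (λ V → (V ++ [ ML ]) ++ [ M ]) ρc₁r≡) (++-assoc (ρ ++ c₁ ∷ r ∷ []) [ ML ] [ M ])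
  body<ML : All (_< ML) (ρ ++ c₁ ∷ r ∷ [])
  body<ML = subst (All (_< ML)) ρc₁r≡ (All.++⁺ U<ML (r<ML ∷ []))

des-snoc-snoc : ∀ w {a b} → All (_< a) w → a < b → des ((w ++ [ a ]) ++ [ b ]) ≡ des w
des-snoc-snoc w {a} {b} w<a a<b =
  trans (des-snoc-max (w ++ [ a ]) b (All.++⁺ (All.map (λ x<a → <-trans x<a a<b) w<a) (a<b ∷ [])))
        (des-snoc-max w a w<a)

single-right-arith : ∀ {d dU} a → d ≤ suc dU → 2 * dU ≤ a →
  (2 * d ≤ a + 2) × (2 * d + 2 ≡ suc (suc a) + 2 → 2 * dU + 1 ≡ suc a × d ≡ suc dU)
single-right-arith {d} {dU} a d≤ 2dU≤a = bound , equality
  where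
  twice-suc : ∀ x → 2 * suc x ≡ 2 * x + 2
  twice-suc = solve-∀
  bound : 2 * d ≤ a + 2
  bound = ≤-trans (*-monoʳ-≤ 2 d≤) (≤-trans (≤-reflexive (twice-suc dU)) (+-monoˡ-≤ 2 2dU≤a))
  equality : 2 * d + 2 ≡ suc (suc a) + 2 → 2 * dU + 1 ≡ suc a × d ≡ suc dU
  equality eq = trans (cong (_+ 1) 2dU≡a) (+-comm a 1) , *-cancelˡ-≡ d (suc dU) 2 2d≡
    where
    2d≡a+2 : 2 * d ≡ a + 2
    2d≡a+2 = +-cancelʳ-≡ 2 (2 * d) (a + 2) (trans eq (cong (_+ 2) (+-comm 2 a)))
    2dU≡a : 2 * dU ≡ a
    2dU≡a = ≤-antisym 2dU≤a (+-cancelʳ-≤ 2 a (2 * dU)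
      (≤-trans (≤-reflexive (sym 2d≡a+2)) (≤-trans (*-monoʳ-≤ 2 d≤) (≤-reflexive (twice-suc dU)))))
    2d≡ : 2 * d ≡ 2 * suc dU
    2d≡ = trans 2d≡a+2 (trans (cong (_+ 2) (sym 2dU≡a)) (sym (twice-suc dU)))

junction-gap : ∀ {d} a b → 2 * d ≤ suc a + suc b → 2 * d + 3 ≤ suc (suc a) + suc (suc (suc b))
junction-gap {d} a b le = ≤-trans (+-monoˡ-≤ 3 le) (≤-reflexive (gap-eq a b))
  where
  gap-eq : ∀ a b → suc a + suc b + 3 ≡ suc (suc a) + suc (suc (suc b))
  gap-eq = solve-∀

left-max-cases : ∀ ν U r R {ML M} → s (s ν) ≡ ((U ++ s (s (r ∷ R))) ++ [ ML ]) ++ [ M ] →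
  length ν ≡ suc (length U) + suc (suc (length R)) →
  All (_< ML) U → All (_< ML) (r ∷ R) → ML < M →
  2 * des U ≤ length U ∸ 1 → (2 * des U + 1 ≡ length U → Extremal2 (U ++ [ ML ])) →
  TwoPassBound (r ∷ R) → TwoPassBound ν
left-max-cases ν U r R {ML} {M} ss-eq |ν| U<ML rR<ML ML<M boundU extremalU (boundR , _) = cases U refl R refl
  where
  V : List ℕ
  V = s (s (r ∷ R))
  d-eq : des (s (s ν)) ≡ des (U ++ V)
  d-eq = trans (cong des ss-eq) (des-snoc-snoc (U ++ V) (All.++⁺ U<ML (All-s (All-s rR<ML))) ML<M)
  cases : ∀ U' → U ≡ U' → ∀ R' → R ≡ R' → TwoPassBound ν
  cases [] refl _ _ = strict-two-pass ν (≤-trans (subst (λ d → 2 * d + 3 ≤ _) (sym d-eq)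
    (one-pass-gap (suc (length R)) (des V) (s≤s z≤n) (≤-trans boundR (∸-monoʳ-≤ (suc (length R)) (n≤1+n 1)))))
    (≤-reflexive (sym |ν|)))
  cases (u ∷ U') refl (r₂ ∷ R') refl = strict-two-pass ν (≤-trans (subst (λ d → 2 * d + 3 ≤ _) (sym d-eq)
    (junction-gap {des (U ++ V)} (length U') (length R') (junction-bound (des U) (des V) (des-++-≤ U V) boundU boundR)))
    (≤-reflexive (sym |ν|)))
  cases (u ∷ U') refl [] refl = bound , equality
    where
    arith : (2 * des (U ++ [ r ]) ≤ length U' + 2) ×
            (2 * des (U ++ [ r ]) + 2 ≡ suc (suc (length U')) + 2 → 2 * des U + 1 ≡ suc (length U') × des (U ++ [ r ]) ≡ suc (des U))
    arith = single-right-arith (length U') (des-snoc-≤ U r) boundU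
    bound : 2 * des (s (s ν)) ≤ length ν ∸ 2
    bound = subst₂ (λ d l → 2 * d ≤ l ∸ 2) (sym d-eq) (sym |ν|) (proj₁ arith)
    equality : 2 * des (s (s ν)) + 2 ≡ length ν → Extremal2 (s (s ν))
    equality eq with proj₂ arith (trans (cong (λ d → 2 * d + 2) (sym d-eq)) (trans eq |ν|))
    ... | equalU , descent = subst Extremal2 (sym ss-eq)
      (extremal-left-max U U<ML (All.head rR<ML) ML<M (extremalU equalU) descent)

-- If the left part holds the larger half-maximum ML, then s²ν = U V ML M where s²L = U ML.
two-pass-left-max : ∀ XL ML YL M r R → All (_< M) (XL ++ ML ∷ YL) → All (_< M) (r ∷ R) →
  All (_< ML) XL → All (_< ML) YL → All (_< ML) (r ∷ R) →
  TwoPassBound (XL ++ ML ∷ YL) → TwoPassBound (r ∷ R) → TwoPassBound ((XL ++ ML ∷ YL) ++ M ∷ r ∷ R)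
two-pass-left-max XL ML YL M r R L<M R<M XL<ML YL<ML R<ML (boundL , extremalL) resR =
  left-max-cases ν U r R ss-eq |ν| (All-s σL<ML) R<ML ML<M boundU extremalU resR
  where
  L ν σL U : List ℕ
  L = XL ++ ML ∷ YL
  ν = L ++ M ∷ r ∷ R
  σL = s XL ++ s YL
  U = s σL
  σL<ML : All (_< ML) σL
  σL<ML = All-resp-↭ (↭-sym (s-pair-↭ XL YL)) (All.++⁺ XL<ML YL<ML)
  sL≡ : s L ≡ σL ++ [ ML ]
  sL≡ = s-max XL YL XL<ML YL<ML
  ss-eq : s (s ν) ≡ ((U ++ s (s (r ∷ R))) ++ [ ML ]) ++ [ M ]
  ss-eq = begin
    s (s ν)                                  ≡⟨ s²-max L (r ∷ R) L<M R<M ⟩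
    s (s L ++ s (r ∷ R)) ++ [ M ]            ≡⟨ cong (λ w → s (w ++ s (r ∷ R)) ++ [ M ]) sL≡ ⟩
    s ((σL ++ [ ML ]) ++ s (r ∷ R)) ++ [ M ] ≡⟨ cong (λ w → s w ++ [ M ]) (++-assoc σL [ ML ] _) ⟩
    s (σL ++ ML ∷ s (r ∷ R)) ++ [ M ]        ≡⟨ cong (_++ [ M ]) (s-max σL (s (r ∷ R)) σL<ML (All-s R<ML)) ⟩
    ((U ++ s (s (r ∷ R))) ++ [ ML ]) ++ [ M ] ∎
    where open ≡-Reasoning
  ssL : s (s L) ≡ U ++ [ ML ]
  ssL = trans (cong s sL≡) (s-snoc-max σL σL<ML)
  dL : des (s (s L)) ≡ des U
  dL = trans (cong des ssL) (des-snoc-max U ML (All-s σL<ML))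
  |L| : length L ≡ suc (length U)
  |L| = trans (length-mid XL ML YL)
    (cong suc (sym (trans (s-length σL) (trans (↭-length (s-pair-↭ XL YL)) (length-++ XL)))))
  |ν| : length ν ≡ suc (length U) + suc (suc (length R))
  |ν| = trans (length-++ L) (cong (_+ _) |L|)
  boundU : 2 * des U ≤ length U ∸ 1
  boundU = subst₂ (λ d l → 2 * d ≤ l ∸ 2) dL |L| boundL
  extremalU : 2 * des U + 1 ≡ length U → Extremal2 (U ++ [ ML ])
  extremalU eq = subst Extremal2 ssL (extremalL
    (trans (cong (λ d → 2 * d + 2) dL) (trans (+-suc (2 * des U) 1) (trans (cong suc eq) (sym |L|)))))
  ML<M : ML < M
  ML<M = All.lookup L<M (∈-insert XL)

Unique-apart : ∀ L {M : ℕ} R {x y} → Unique (L ++ M ∷ R) → x ∈ L → y ∈ R → x ≢ y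
Unique-apart L R u x∈L y∈R with AllPairs-++⁻ L u
... | _ , _ , cross = All.lookup (All.lookup cross x∈L) (there y∈R)

-- Two passes leave at most (|ν| − 2)/2 descents, with equality only for the extremal shape.
-- Induction through the maximum M of ν = L M R, comparing the maxima of L and R.
two-pass-bound : ∀ ν → Unique ν → TwoPassBound ν
two-pass-bound = MaxInduction.max-induction TwoPassBound (z≤n , λ ()) step
  where
  step : ∀ L M R → All (_< M) L → All (_< M) R → Unique (L ++ M ∷ R) →
    TwoPassBound L → TwoPassBound R → TwoPassBound (L ++ M ∷ R)
  step []      M R       _   R<M _ _    resR = two-pass-one-sided (M ∷ R) R R<M (s²-max [] R [] R<M) refl resR
  step (l ∷ L) M []      L<M _   _ resL _    = two-pass-one-sided ((l ∷ L) ++ [ M ]) (l ∷ L) L<M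
    (trans (s²-max (l ∷ L) [] L<M []) (cong (λ w → s w ++ [ M ]) (++-identityʳ (s (l ∷ L)))))
    (trans (length-++ (l ∷ L)) (+-comm (length (l ∷ L)) 1)) resL
  step (l ∷ L) M (r ∷ R) L<M R<M u resL resR
    with maxSplit l L (proj₁ (Unique-halves (l ∷ L) (r ∷ R) u))
       | maxSplit r R (proj₂ (Unique-halves (l ∷ L) (r ∷ R) u))
  ... | max-split XL ML YL eqL XL<ML YL<ML | max-split XR MR YR eqR XR<MR YR<MR with <-cmp ML MR
  ... | tri< ML<MR _ _ = subst (λ R' → TwoPassBound ((l ∷ L) ++ M ∷ R')) (sym eqR)
    (two-pass-right-max (l ∷ L) M XR MR YR L<M (subst (All (_< M)) eqR R<M)
      (subst (All (_< MR)) (sym eqL) (All<-lift XL<ML YL<ML ML<MR)) XR<MR YR<MR (s≤s z≤n)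
      (subst (λ R' → Unique ((l ∷ L) ++ M ∷ R')) eqR u))
  ... | tri> _ _ MR<ML = subst (λ L' → TwoPassBound (L' ++ M ∷ r ∷ R)) (sym eqL)
    (two-pass-left-max XL ML YL M r R (subst (All (_< M)) eqL L<M) R<M XL<ML YL<ML
      (subst (All (_< ML)) (sym eqR) (All<-lift XR<MR YR<MR MR<ML)) (subst TwoPassBound eqL resL) resR)
  ... | tri≈ _ ML≡MR _ = ⊥-elim (Unique-apart (l ∷ L) (r ∷ R) u
    (subst (ML ∈_) (sym eqL) (∈-insert XL)) (subst (MR ∈_) (sym eqR) (∈-insert XR)) ML≡MR)

record Shape (n t : ℕ) (π : List ℕ) : Set where
  constructor shape
  field
    front back : List ℕ
    split : π ≡ front ++ back
    alternating : Alternating front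
    front-length : length front + t ≡ n
    rising : RisingTail front back

flip-above : ∀ τ {D : List ℕ} → All (λ d → All (_< d) τ) D → All (λ x → All (x <_) D) τ
flip-above []      _   = []
flip-above (x ∷ τ) τ<D = All.map All.head τ<D ∷ flip-above τ (All.map All.tail τ<D)

RisingTail-++ : ∀ ρ τ D → RisingTail ρ τ → RisingTail (ρ ++ τ) D → RisingTail ρ (τ ++ D)
RisingTail-++ ρ τ D (incτ , ρ<τ) (incD , ρτ<D) =
  AllPairs.++⁺ incτ incD (flip-above τ (All.map (All.++⁻ʳ ρ) ρτ<D)) ,
  All.++⁺ ρ<τ (All.map (All.++⁻ˡ ρ) ρτ<D)

Extremal2-rising : ∀ {ρ c₁ c₂} → All (_< c₁) ρ → c₁ < c₂ → RisingTail ρ (c₁ ∷ c₂ ∷ [])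
Extremal2-rising ρ<c₁ c₁<c₂ = ((c₁<c₂ ∷ []) ∷ [] ∷ []) , (ρ<c₁ ∷ All.map (λ x<c₁ → <-trans x<c₁ c₁<c₂) ρ<c₁ ∷ [])

front-length-arith : ∀ l t' n → l + t' ≡ n → suc (suc t') ≤ n → (n ∸ suc (suc t')) + 2 ≡ l
front-length-arith l t' n eq t≤n = +-cancelʳ-≡ t' _ _ (trans (regroup (n ∸ suc (suc t')) t')
  (trans (m∸n+n≡m t≤n) (sym eq)))
  where
  regroup : ∀ a t' → a + 2 + t' ≡ a + suc (suc t')
  regroup = solve-∀

range-length : ∀ n → length (range n) ≡ n
range-length n = trans (length-map suc (upTo n)) (length-upTo n)

range-unique : ∀ n → Unique (range n)
range-unique n = Unique.map⁺ suc-injective (Unique.upTo⁺ n)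

range-positive : ∀ n → All (1 ≤_) (range n)
range-positive n = All.map⁺ (All.universal (λ _ → s≤s z≤n) (upTo n))

-- After t − 2 passes the top t − 2 entries are a rising tail D behind ν; the last two passes
-- act on ν alone, and the descent count forces equality in the two-pass bound.
shape-of-extremal : ∀ n t π → 2 ≤ t → t ≤ n → IsPerm n π → TSorted t π → 2 * des π ≡ n ∸ t → Shape n t π
shape-of-extremal n (suc (suc t')) π (s≤s (s≤s _)) t≤n π↭ (μ , (uμ , _) , s^tμ≡π) 2desπ =
  shape ρ (c₁ ∷ c₂ ∷ D) π-split alternating |ρ| rising
  where
  t : ℕ
  t = suc (suc t')
  |μ| : length μ ≡ n
  |μ| = trans (sym (↭-length (s^-↭ t μ))) (trans (cong length s^tμ≡π) (trans (↭-length π↭) (range-length n)))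
  open TopFixed (top-fixed-after-passes t' μ (≤-trans (n≤1+n t') (≤-trans (n≤1+n _) (subst (t ≤_) (sym |μ|) t≤n))) uμ)
    renaming (front to ν; tail to D; split to μ-split; front-length to |ν|; rising to D-rising)
  uν : Unique ν
  uν = proj₁ (Unique-++⁻ ν (subst Unique μ-split (Unique-resp-↭ (↭-sym (s^-↭ t' μ)) uμ)))
  D-rising² : RisingTail (s (s ν)) D
  D-rising² = RisingTail-↭ (↭-trans (s-↭ (s ν)) (s-↭ ν)) D-rising
  π≡ : π ≡ s (s ν) ++ D
  π≡ = trans (sym s^tμ≡π) (trans (cong (s ∘ s) μ-split)
    (trans (cong s (s-rising-tail ν D D-rising)) (s-rising-tail (s ν) D (RisingTail-↭ (s-↭ ν) D-rising))))
  des-eq : des π ≡ des (s (s ν))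
  des-eq = trans (cong des π≡) (des-rising-tail (s (s ν)) D D-rising²)
  equality : 2 * des (s (s ν)) + 2 ≡ length ν
  equality = trans (cong (λ d → 2 * d + 2) (sym des-eq))
    (trans (cong (_+ 2) 2desπ) (front-length-arith (length ν) t' n (trans |ν| |μ|) t≤n))
  open Extremal2 (proj₂ (two-pass-bound ν uν) equality) renaming (body to ρ; split to ss-split)
  π-split : π ≡ ρ ++ c₁ ∷ c₂ ∷ D
  π-split = trans π≡ (trans (cong (_++ D) ss-split) (++-assoc ρ (c₁ ∷ c₂ ∷ []) D))
  rising : RisingTail ρ (c₁ ∷ c₂ ∷ D)
  rising = RisingTail-++ ρ (c₁ ∷ c₂ ∷ []) D (Extremal2-rising body<c₁ c₁<c₂) (subst (λ w → RisingTail w D) ss-split D-rising²)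
  |ρ| : length ρ + t ≡ n
  |ρ| = begin
    length ρ + suc (suc t')          ≡⟨ regroup (length ρ) t' ⟩
    (length ρ + 2) + t'              ≡⟨ cong (_+ t') (sym (length-++ ρ)) ⟩
    length (ρ ++ c₁ ∷ c₂ ∷ []) + t'  ≡⟨ cong (λ w → length w + t') (sym ss-split) ⟩
    length (s (s ν)) + t'            ≡⟨ cong (_+ t') (trans (s-length (s ν)) (s-length ν)) ⟩
    length ν + t'                    ≡⟨ trans |ν| |μ| ⟩
    n                                ∎
    where
    open ≡-Reasoning
    regroup : ∀ a b → a + suc (suc b) ≡ (a + 2) + b
    regroup = solve-∀

des-alternating : ∀ {ρ} → Alternating ρ → 2 * des ρ ≡ length ρ
des-alternating alt-[] = refl
des-alternating (alt-snoc {ρ} {a} {b} alt ρ<a b<a) = begin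
  2 * des (ρ ++ a ∷ b ∷ [])                              ≡⟨ cong (2 *_) (des-split ρ a [ b ]) ⟩
  2 * (des (ρ ++ [ a ]) + ((if b <ᵇ a then 1 else 0) + 0)) ≡⟨ cong₂ (λ x y → 2 * (x + (y + 0)))
                                                             (des-snoc-max ρ a ρ<a) (if-true (<ᵇ-true b<a)) ⟩
  2 * (des ρ + 1)                                        ≡⟨ *-distribˡ-+ 2 (des ρ) 1 ⟩
  2 * des ρ + 2                                          ≡⟨ cong (_+ 2) (des-alternating alt) ⟩
  length ρ + 2                                           ≡⟨ sym (length-++ ρ) ⟩
  length (ρ ++ a ∷ b ∷ [])                               ∎
  where open ≡-Reasoning

interleave : List ℕ → List ℕ → List ℕ
interleave []       bs       = bs
interleave (a ∷ as) []       = a ∷ as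
interleave (a ∷ as) (b ∷ bs) = a ∷ b ∷ interleave as bs

interleave-↭ : ∀ as bs → interleave as bs ↭ as ++ bs
interleave-↭ []       bs       = ↭-refl
interleave-↭ (a ∷ as) []       = ↭-reflexive (cong (a ∷_) (sym (++-identityʳ as)))
interleave-↭ (a ∷ as) (b ∷ bs) = prep a (↭-trans (prep b (interleave-↭ as bs)) (↭-sym (shift b as bs)))

All-interleave⁻ˡ : ∀ {P : ℕ → Set} as bs → All P (interleave as bs) → All P as
All-interleave⁻ˡ []       bs       _              = []
All-interleave⁻ˡ (a ∷ as) []       p              = p
All-interleave⁻ˡ (a ∷ as) (b ∷ bs) (pa ∷ _ ∷ p)   = pa ∷ All-interleave⁻ˡ as bs p

interleave-++ : ∀ as bs τ → length as ≡ length bs → interleave as bs ++ τ ≡ interleave (as ++ τ) bs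
interleave-++ []       []       []      _ = refl
interleave-++ []       []       (_ ∷ _) _ = refl
interleave-++ (a ∷ as) (b ∷ bs) τ       e = cong (λ w → a ∷ b ∷ w) (interleave-++ as bs τ (suc-injective e))

interleave-snoc : ∀ as bs a b → length as ≡ length bs →
  interleave as bs ++ a ∷ b ∷ [] ≡ interleave (as ++ [ a ]) (bs ++ [ b ])
interleave-snoc []       []       a b _ = refl
interleave-snoc (x ∷ as) (y ∷ bs) a b e = cong (λ w → x ∷ y ∷ w) (interleave-snoc as bs a b (suc-injective e))

Prefix-snoc : ∀ {bs as b a} → length bs ≡ length as → Prefix _<_ bs as → b < a → Prefix _<_ (bs ++ [ b ]) (as ++ [ a ])
Prefix-snoc {[]}    {[]}    _ []           b<a = b<a ∷ []
Prefix-snoc {_ ∷ _} {_ ∷ _} e (lt ∷ below) b<a = lt ∷ Prefix-snoc (suc-injective e) below b<a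

record PeaksValleys (ρ : List ℕ) : Set where
  constructor peaks-valleys
  field
    peaks valleys : List ℕ
    split : ρ ≡ interleave peaks valleys
    same-length : length peaks ≡ length valleys
    increasing : AllPairs _<_ peaks
    below : Prefix _<_ valleys peaks

alternating-peaks : ∀ {ρ} → Alternating ρ → PeaksValleys ρ
alternating-peaks alt-[] = peaks-valleys [] [] refl refl [] []
alternating-peaks (alt-snoc {ρ} {a} {b} alt ρ<a b<a) with alternating-peaks alt
... | peaks-valleys as bs eq len inc below =
  peaks-valleys (as ++ [ a ]) (bs ++ [ b ])
    (trans (cong (_++ a ∷ b ∷ []) eq) (interleave-snoc as bs a b len))
    (trans (length-++ as) (trans (cong (_+ 1) len) (sym (length-++ bs))))
    (AllPairs.++⁺ inc ([] ∷ []) (All.map (_∷ []) (All-interleave⁻ˡ as bs (subst (All (_< a)) eq ρ<a))))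
    (Prefix-snoc (sym len) below b<a)

-- Feeding z₁ b₁ z₂ b₂ … with bᵢ < zᵢ to a stack holding a smaller y outputs y b₁ z₁ b₂ z₂ …:
-- each peak pushes out the previous peak, after its valley has been pushed out by it.
run-interleave : ∀ y zs bs out → AllPairs _<_ (y ∷ zs) → Prefix _<_ bs zs →
  run (interleave zs bs) [ y ] out ≡ out ++ interleave (y ∷ zs) bs
run-interleave y []       []       out _ _ = refl
run-interleave y (z ∷ zs) []       out inc _ = run-increasing y (z ∷ zs) out inc
run-interleave y (z ∷ zs) (b ∷ bs) out ((y<z ∷ _) ∷ inc) (b<z ∷ below) = begin
  run (z ∷ b ∷ interleave zs bs) [ y ] out                 ≡⟨ if-false (<ᵇ-false (<⇒≤ y<z)) ⟩
  run (b ∷ interleave zs bs) [ z ] (out ++ [ y ])          ≡⟨ if-true (<ᵇ-true b<z) ⟩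
  run (interleave zs bs) (b ∷ z ∷ []) (out ++ [ y ])       ≡⟨ pop-valley zs bs inc below ⟩
  run (interleave zs bs) [ z ] ((out ++ [ y ]) ++ [ b ])   ≡⟨ run-interleave z zs bs _ inc below ⟩
  ((out ++ [ y ]) ++ [ b ]) ++ interleave (z ∷ zs) bs      ≡⟨ ++-assoc (out ++ [ y ]) [ b ] _ ⟩
  (out ++ [ y ]) ++ b ∷ interleave (z ∷ zs) bs             ≡⟨ ++-assoc out [ y ] _ ⟩
  out ++ y ∷ b ∷ interleave (z ∷ zs) bs                    ∎
  where
  open ≡-Reasoning
  -- The valley b on top of z leaves before the next (larger) peak arrives.
  pop-valley : ∀ zs bs {o} → AllPairs _<_ (z ∷ zs) → Prefix _<_ bs zs →
    run (interleave zs bs) (b ∷ z ∷ []) o ≡ run (interleave zs bs) [ z ] (o ++ [ b ])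
  pop-valley []       []      _                 _ = refl
  pop-valley (w ∷ zs) []      ((z<w ∷ _) ∷ _) _ = if-false (<ᵇ-false (<⇒≤ (<-trans b<z z<w)))
  pop-valley (w ∷ zs) (_ ∷ _) ((z<w ∷ _) ∷ _) _ = if-false (<ᵇ-false (<⇒≤ (<-trans b<z z<w)))

-- The preimage: the first j peaks are held back in front of the interleaving of the rest.
delay : ℕ → List ℕ → List ℕ → List ℕ
delay zero    as       bs = interleave as bs
delay (suc j) []       bs = bs
delay (suc j) (a ∷ as) bs = a ∷ delay j as bs

delay-↭ : ∀ j as bs → delay j as bs ↭ as ++ bs
delay-↭ zero    as       bs = interleave-↭ as bs
delay-↭ (suc j) []       bs = ↭-refl
delay-↭ (suc j) (a ∷ as) bs = prep a (delay-↭ j as bs)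

run-delay : ∀ j y zs bs out → AllPairs _<_ (y ∷ zs) → Prefix _<_ bs (drop j zs) →
  run (delay j zs bs) [ y ] out ≡ out ++ delay j (y ∷ zs) bs
run-delay zero    y zs       bs out inc below = run-interleave y zs bs out inc below
run-delay (suc j) y []       [] out _   _     = cong (λ w → out ++ y ∷ w) (sym (delay-[] j))
  where
  delay-[] : ∀ j → delay j [] [] ≡ []
  delay-[] zero    = refl
  delay-[] (suc j) = refl
run-delay (suc j) y (z ∷ zs) bs out ((y<z ∷ _) ∷ inc) below =
  trans (if-false (<ᵇ-false (<⇒≤ y<z))) (trans (run-delay j z zs bs (out ++ [ y ]) inc below) (++-assoc out [ y ] _))

s-delay : ∀ j y zs bs → AllPairs _<_ (y ∷ zs) → Prefix _<_ bs (drop j zs) →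
  s (delay (suc j) (y ∷ zs) bs) ≡ delay j (y ∷ zs) bs
s-delay j y zs bs inc below = run-delay j y zs bs [] inc below

Prefix-drop : ∀ i zs bs → AllPairs _<_ zs → Prefix _<_ bs zs → length bs + i ≤ length zs → Prefix _<_ bs (drop i zs)
Prefix-drop zero    zs       bs _ below _ = below
Prefix-drop (suc i) []       bs _ below le = ⊥-elim (n≮0 (subst (_≤ 0) (+-suc (length bs) i) le))
Prefix-drop (suc i) (y ∷ zs) bs inc@(_ ∷ inc') below le =
  Prefix-drop i zs bs inc' (shift-left y zs bs inc below (≤-trans (m≤m+n (length bs) i) le')) le'
  where
  le' : length bs + i ≤ length zs
  le' = s≤s⁻¹ (subst (_≤ suc (length zs)) (+-suc (length bs) i) le)
  shift-left : ∀ y zs bs → AllPairs _<_ (y ∷ zs) → Prefix _<_ bs (y ∷ zs) → length bs ≤ length zs → Prefix _<_ bs zs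
  shift-left y zs       []       _ _ _ = []
  shift-left y (z ∷ zs) (b ∷ bs) ((y<z ∷ _) ∷ inc) (b<y ∷ below) (s≤s le) =
    <-trans b<y y<z ∷ shift-left z zs bs inc below le

s^-delay : ∀ j zs bs → AllPairs _<_ zs → Prefix _<_ bs zs → length bs + j ≤ length zs → s^ j (delay j zs bs) ≡ interleave zs bs
s^-delay zero    zs       bs _ _ _ = refl
s^-delay (suc j) []       bs _ _ le = ⊥-elim (n≮0 (subst (_≤ 0) (+-suc (length bs) j) le))
s^-delay (suc j) (y ∷ zs) bs inc below le =
  trans (s^-suc j (delay (suc j) (y ∷ zs) bs))
    (trans (cong (s^ j) (s-delay j y zs bs inc (Prefix-drop (suc j) (y ∷ zs) bs inc below le)))
      (s^-delay j (y ∷ zs) bs inc below (≤-trans (+-monoʳ-≤ (length bs) (n≤1+n j)) le)))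

Shape-back-length : ∀ {n t π} → IsPerm n π → (sh : Shape n t π) → length (Shape.back sh) ≡ t
Shape-back-length {n} {t} {π} π↭ (shape ρ τ split _ |ρ| _) = +-cancelˡ-≡ (length ρ) (length τ) t
  (trans (sym (length-++ ρ)) (trans (cong length (sym split)) (trans (↭-length π↭) (trans (range-length n) (sym |ρ|)))))

-- Backward direction: a permutation of the shape is t-sorted with (n − t)/2 descents. Writing
-- π = interleave (peaks ++ τ) valleys, the preimage holds back the first t peaks.
extremal-of-shape : ∀ n t π → IsPerm n π → Shape n t π → TSorted t π × 2 * des π ≡ n ∸ t
extremal-of-shape n t π π↭ sh@(shape ρ τ split alt |ρ| rising@(incτ , ρ<τ)) with alternating-peaks alt
... | peaks-valleys as bs ρ≡ same inc below = (μ , (uμ , posμ) , s^tμ≡π) , des-eq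
  where
  zs : List ℕ
  zs = as ++ τ
  π≡ : π ≡ interleave zs bs
  π≡ = trans split (trans (cong (_++ τ) ρ≡) (interleave-++ as bs τ same))
  inc-zs : AllPairs _<_ zs
  inc-zs = AllPairs.++⁺ inc incτ (All-interleave⁻ˡ as bs (subst (All _) ρ≡ (flip-above ρ ρ<τ)))
  fits : length bs + t ≤ length zs
  fits = ≤-reflexive (trans (cong₂ _+_ (sym same) (sym (Shape-back-length π↭ sh))) (sym (length-++ as)))
  μ : List ℕ
  μ = delay t zs bs
  s^tμ≡π : s^ t μ ≡ π
  s^tμ≡π = trans (s^-delay t zs bs inc-zs (below ++ᵖ τ) fits) (sym π≡)
  μ↭ : μ ↭ range n
  μ↭ = ↭-trans (delay-↭ t zs bs) (↭-trans (↭-sym (interleave-↭ zs bs)) (subst (_↭ range n) π≡ π↭))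
  uμ : Unique μ
  uμ = Unique-resp-↭ (↭-sym μ↭) (range-unique n)
  posμ : All (1 ≤_) μ
  posμ = All-resp-↭ (↭-sym μ↭) (range-positive n)
  des-eq : 2 * des π ≡ n ∸ t
  des-eq = trans (cong (λ w → 2 * des w) split) (trans (cong (2 *_) (des-rising-tail ρ τ rising))
    (trans (des-alternating alt) (trans (sym (m+n∸n≡m (length ρ) t)) (cong (_∸ t) |ρ|))))

infix 3 _⟺_
_⟺_ : Set → Set → Set
A ⟺ B = (A → B) × (B → A)

⟺-sym : ∀ {A B} → A ⟺ B → B ⟺ A
⟺-sym (to , from) = from , to

⟺-trans : ∀ {A B C} → A ⟺ B → B ⟺ C → A ⟺ C
⟺-trans (to₁ , from₁) (to₂ , from₂) = to₂ ∘ to₁ , from₁ ∘ from₂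

IsLTRMaxAfter : List ℕ → (π : List ℕ) → Fin (length π) → Set
IsLTRMaxAfter p π i = All (_< lookup π i) p × IsLTRMax π i

LTRExactly : (ℕ → Set) → List ℕ → List ℕ → Set
LTRExactly g p π = ∀ i → IsLTRMaxAfter p π i ⟺ g (length p + toℕ i)

length-snoc-+ : ∀ (p : List ℕ) y k → length (p ++ [ y ]) + k ≡ length p + suc k
length-snoc-+ p y k = trans (cong (_+ k) (trans (length-++ p) (+-comm (length p) 1))) (sym (+-suc (length p) k))

IsLTRMaxAfter-zero : ∀ p y π → IsLTRMaxAfter p (y ∷ π) fzero ⟺ All (_< y) p
IsLTRMaxAfter-zero p y π = proj₁ , λ p<y → p<y , λ _ ()

IsLTRMaxAfter-suc : ∀ p y π i → IsLTRMaxAfter p (y ∷ π) (fsuc i) ⟺ IsLTRMaxAfter (p ++ [ y ]) π i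
IsLTRMaxAfter-suc p y π i = to , from
  where
  to : IsLTRMaxAfter p (y ∷ π) (fsuc i) → IsLTRMaxAfter (p ++ [ y ]) π i
  to (p< , earlier<) = All.++⁺ p< (earlier< fzero (s≤s z≤n) ∷ []) , λ j j<i → earlier< (fsuc j) (s≤s j<i)
  from : IsLTRMaxAfter (p ++ [ y ]) π i → IsLTRMaxAfter p (y ∷ π) (fsuc i)
  from (py< , earlier<) = All.++⁻ˡ p py< , λ
    { fzero    _         → All.head (All.++⁻ʳ p py<)
    ; (fsuc j) (s≤s j<i) → earlier< j j<i }

LTRExactly-∷ : ∀ {g : ℕ → Set} p y π →
  LTRExactly g p (y ∷ π) ⟺ ((All (_< y) p ⟺ g (length p)) × LTRExactly g (p ++ [ y ]) π)
LTRExactly-∷ {g} p y π = to , from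
  where
  g-zero : g (length p + 0) ⟺ g (length p)
  g-zero = subst g (+-identityʳ _) , subst g (sym (+-identityʳ _))
  g-suc : ∀ i → g (length p + suc (toℕ i)) ⟺ g (length (p ++ [ y ]) + toℕ i)
  g-suc i = subst g (sym (length-snoc-+ p y (toℕ i))) , subst g (length-snoc-+ p y (toℕ i))
  to : LTRExactly g p (y ∷ π) → (All (_< y) p ⟺ g (length p)) × LTRExactly g (p ++ [ y ]) π
  to exact = ⟺-trans (⟺-sym (IsLTRMaxAfter-zero p y π)) (⟺-trans (exact fzero) g-zero) ,
    λ i → ⟺-trans (⟺-sym (IsLTRMaxAfter-suc p y π i)) (⟺-trans (exact (fsuc i)) (g-suc i))
  from : (All (_< y) p ⟺ g (length p)) × LTRExactly g (p ++ [ y ]) π → LTRExactly g p (y ∷ π)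
  from (first , exact) fzero    = ⟺-trans (IsLTRMaxAfter-zero p y π) (⟺-trans first (⟺-sym g-zero))
  from (_     , exact) (fsuc i) = ⟺-trans (IsLTRMaxAfter-suc p y π i) (⟺-trans (exact i) (⟺-sym (g-suc i)))

LTRPattern⟺LTRExactly : ∀ n t π → LTRPattern n t π ⟺ LTRExactly (λ k → InPattern n t (suc k)) [] π
LTRPattern⟺LTRExactly n t π = (λ pat i → ⟺-trans (⟺-sym at-start) (pat i)) , (λ exact i → ⟺-trans at-start (exact i))
  where
  at-start : ∀ {i} → IsLTRMax π i ⟺ IsLTRMaxAfter [] π i
  at-start = (λ max → [] , max) , proj₂

data Reading : ℕ → List ℕ → List ℕ → Set where
  reading-[]   : ∀ {p} → Reading 0 p []
  reading-max  : ∀ {p y τ} → All (_< y) p → Reading 0 (p ++ [ y ]) τ → Reading 0 p (y ∷ τ)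
  reading-pair : ∀ {K p a b ρ} → All (_< a) p → b < a → Reading K (p ++ a ∷ b ∷ []) ρ → Reading (suc K) p (a ∷ b ∷ ρ)

double-suc : ∀ m → 2 * suc m ≡ suc (suc (2 * m))
double-suc = solve-∀

-- The positions of the theorem's pattern (0-based), when n − t = 2K: the even positions below 2K,
-- and every position from 2K on.
module PatternPositions (n t K : ℕ) (2K≡n-t : 2 * K ≡ n ∸ t) where

  InPattern₀ : ℕ → Set
  InPattern₀ k = InPattern n t (suc k)

  pair-peak : ∀ m → m < K → InPattern₀ (2 * m)
  pair-peak m m<K = inj₁ ((m , refl) , ≤-trans (≤-reflexive (+-comm 1 (2 * m)))
    (+-monoˡ-≤ 1 (≤-trans (*-monoʳ-≤ 2 (<⇒≤ m<K)) (≤-reflexive 2K≡n-t))))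

  pair-valley : ∀ m → m < K → ¬ InPattern₀ (suc (2 * m))
  pair-valley m m<K (inj₁ ((m' , e) , _)) = even≢odd (suc m) m' (trans (double-suc m) e)
  pair-valley m m<K (inj₂ (le , _)) = <-irrefl refl (begin-strict
    2 * K + 2         ≡⟨ cong (_+ 2) 2K≡n-t ⟩
    n ∸ t + 2         ≤⟨ le ⟩
    suc (suc (2 * m)) ≡⟨ sym (double-suc m) ⟩
    2 * suc m         ≤⟨ *-monoʳ-≤ 2 m<K ⟩
    2 * K             <⟨ m<m+n (2 * K) (s≤s z≤n) ⟩
    2 * K + 2         ∎)
    where open ≤-Reasoning

  tail-max : ∀ k → 2 * K ≤ k → k < n → InPattern₀ k
  tail-max k 2K≤k k<n with m≤n⇒m<n∨m≡n 2K≤k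
  ... | inj₂ 2K≡k = inj₁ ((K , cong suc (sym 2K≡k)) ,
    ≤-reflexive (trans (cong suc (trans (sym 2K≡k) 2K≡n-t)) (+-comm 1 (n ∸ t))))
  ... | inj₁ 2K<k = inj₂ (≤-trans (≤-reflexive (trans (cong (_+ 2) (sym 2K≡n-t)) (+-comm (2 * K) 2))) (s≤s 2K<k) , k<n)

  private
    p<n : ∀ (p : List ℕ) (y : ℕ) τ → length p + length (y ∷ τ) ≡ n → length p < n
    p<n p y τ len = ≤-trans (m<m+n (length p) {length (y ∷ τ)} (s≤s z≤n)) (≤-reflexive len)
    length-step : ∀ (p : List ℕ) y τ → length p + length (y ∷ τ) ≡ n → length (p ++ [ y ]) + length τ ≡ n
    length-step p y τ len = trans (length-snoc-+ p y (length τ)) len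
    length-pair : ∀ (p : List ℕ) a b ρ → length p + length (a ∷ b ∷ ρ) ≡ n → length (p ++ a ∷ b ∷ []) + length ρ ≡ n
    length-pair p a b ρ len = trans (cong (_+ length ρ) (length-++ p)) (trans (+-assoc (length p) 2 (length ρ)) len)
    length-peak : ∀ (p : List ℕ) a m → length p ≡ 2 * m → length (p ++ [ a ]) ≡ suc (2 * m)
    length-peak p a m |p| = trans (length-++ p) (trans (+-comm _ 1) (cong suc |p|))
    2K≤-step : ∀ (p : List ℕ) y → 2 * K ≤ length p → 2 * K ≤ length (p ++ [ y ])
    2K≤-step p y 2K≤ = ≤-trans 2K≤ (≤-trans (m≤m+n (length p) 1) (≤-reflexive (sym (length-++ p))))
    length-pair-2m : ∀ (p : List ℕ) a b m → length p ≡ 2 * m → length (p ++ a ∷ b ∷ []) ≡ 2 * suc m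
    length-pair-2m p a b m |p| = trans (length-++ p) (trans (cong (_+ 2) |p|) (trans (+-comm (2 * m) 2) (sym (double-suc m))))
    2K≤p : ∀ (p : List ℕ) m → length p ≡ 2 * m → m + 0 ≡ K → 2 * K ≤ length p
    2K≤p p m |p| m≡K = ≤-reflexive (trans (cong (2 *_) (trans (sym m≡K) (+-identityʳ m))) (sym |p|))
    m<K : ∀ m K' → m + suc K' ≡ K → m < K
    m<K m K' eq = ≤-trans (s≤s (m≤m+n m K')) (≤-reflexive (trans (sym (+-suc m K')) eq))
    pair-assoc : ∀ (p : List ℕ) a b → (p ++ [ a ]) ++ [ b ] ≡ p ++ a ∷ b ∷ []
    pair-assoc p a b = ++-assoc p [ a ] [ b ]

  reading-tail⇒exact : ∀ p π → Reading 0 p π → 2 * K ≤ length p → length p + length π ≡ n → LTRExactly InPattern₀ p π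
  reading-tail⇒exact p []      reading-[]              _   _   = λ ()
  reading-tail⇒exact p (y ∷ τ) (reading-max p<y rest) 2K≤ len = proj₂ (LTRExactly-∷ {InPattern₀} p y τ)
    (((λ _ → tail-max (length p) 2K≤ (p<n p y τ len)) , (λ _ → p<y)) ,
     reading-tail⇒exact (p ++ [ y ]) τ rest (2K≤-step p y 2K≤) (length-step p y τ len))

  reading⇒exact : ∀ K' p π m → Reading K' p π → length p ≡ 2 * m → m + K' ≡ K → length p + length π ≡ n →
    LTRExactly InPattern₀ p π
  reading⇒exact zero     p π m rd |p| mK len = reading-tail⇒exact p π rd (2K≤p p m |p| mK) len
  reading⇒exact (suc K') p (a ∷ b ∷ ρ) m (reading-pair p<a b<a rest) |p| mK len =
    proj₂ (LTRExactly-∷ {InPattern₀} p a (b ∷ ρ))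
    (((λ _ → subst InPattern₀ (sym |p|) (pair-peak m (m<K m K' mK))) , (λ _ → p<a)) ,
     proj₂ (LTRExactly-∷ {InPattern₀} (p ++ [ a ]) b ρ)
       (((λ pa<b → ⊥-elim (<-asym b<a (All.head (All.++⁻ʳ p pa<b)))) ,
         (λ valley → ⊥-elim (pair-valley m (m<K m K' mK) (subst InPattern₀ (length-peak p a m |p|) valley)))) ,
        subst (λ q → LTRExactly InPattern₀ q ρ) (sym (pair-assoc p a b))
          (reading⇒exact K' (p ++ a ∷ b ∷ []) ρ (suc m) rest (length-pair-2m p a b m |p|) (trans (sym (+-suc m K')) mK)
            (length-pair p a b ρ len))))

  too-short : ∀ (p : List ℕ) m K' l → l < 2 → length p ≡ 2 * m → m + suc K' ≡ K → length p + l ≢ n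
  too-short p m K' l l<2 |p| mK len = <-irrefl refl (begin-strict
    n                ≡⟨ sym len ⟩
    length p + l     <⟨ +-monoʳ-< (length p) l<2 ⟩
    length p + 2     ≡⟨ trans (cong (_+ 2) |p|) (trans (+-comm (2 * m) 2) (sym (double-suc m))) ⟩
    2 * suc m        ≤⟨ *-monoʳ-≤ 2 (m<K m K' mK) ⟩
    2 * K            ≤⟨ ≤-trans (≤-reflexive 2K≡n-t) (m∸n≤m n t) ⟩
    n                ∎)
    where open ≤-Reasoning

  exact⇒reading-tail : ∀ p π → LTRExactly InPattern₀ p π → 2 * K ≤ length p → length p + length π ≡ n → Reading 0 p π
  exact⇒reading-tail p []      _     _   _   = reading-[]
  exact⇒reading-tail p (y ∷ τ) exact 2K≤ len with proj₁ (LTRExactly-∷ {InPattern₀} p y τ) exact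
  ... | (_ , status←) , rest = reading-max (status← (tail-max (length p) 2K≤ (p<n p y τ len)))
    (exact⇒reading-tail (p ++ [ y ]) τ rest (2K≤-step p y 2K≤) (length-step p y τ len))

  -- The pattern's maxima, from position 2m with K' pairs to go, give a reading; distinctness
  -- turns "the second entry of a pair is no new maximum" into "it is below the first".
  exact⇒reading : ∀ K' p π m → LTRExactly InPattern₀ p π → Unique (p ++ π) → length p ≡ 2 * m → m + K' ≡ K →
    length p + length π ≡ n → Reading K' p π
  exact⇒reading zero     p π           m exact _ |p| mK len = exact⇒reading-tail p π exact (2K≤p p m |p| mK) len
  exact⇒reading (suc K') p []          m _     _ |p| mK len = ⊥-elim (too-short p m K' 0 (s≤s z≤n) |p| mK len)
  exact⇒reading (suc K') p (a ∷ [])    m _     _ |p| mK len = ⊥-elim (too-short p m K' 1 (s≤s (s≤s z≤n)) |p| mK len)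
  exact⇒reading (suc K') p (a ∷ b ∷ ρ) m exact u |p| mK len
    with proj₁ (LTRExactly-∷ {InPattern₀} p a (b ∷ ρ)) exact
  ... | (_ , a-status←) , exact-b with proj₁ (LTRExactly-∷ {InPattern₀} (p ++ [ a ]) b ρ) exact-b
  ... | (b-status→ , _) , exact-ρ = reading-pair p<a b<a
    (exact⇒reading K' (p ++ a ∷ b ∷ []) ρ (suc m) (subst (λ q → LTRExactly InPattern₀ q ρ) (pair-assoc p a b) exact-ρ)
      (subst Unique (sym (++-assoc p (a ∷ b ∷ []) ρ)) u) (length-pair-2m p a b m |p|) (trans (sym (+-suc m K')) mK)
      (length-pair p a b ρ len))
    where
    p<a : All (_< a) p
    p<a = a-status← (subst InPattern₀ (sym |p|) (pair-peak m (m<K m K' mK)))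
    a≢b : a ≢ b
    a≢b with proj₂ (Unique-++⁻ p u)
    ... | (a≢b ∷ _) ∷ _ = a≢b
    b<a : b < a
    b<a with <-cmp b a
    ... | tri< b<a _ _ = b<a
    ... | tri≈ _ b≡a _ = ⊥-elim (a≢b (sym b≡a))
    ... | tri> _ _ a<b = ⊥-elim (pair-valley m (m<K m K' mK)
      (subst InPattern₀ (length-peak p a m |p|)
        (b-status→ (All.++⁺ (All.map (λ x<a → <-trans x<a a<b) p<a) (a<b ∷ [])))))

rising⇒reading : ∀ {p τ} → RisingTail p τ → Reading 0 p τ
rising⇒reading ([] , [])                  = reading-[]
rising⇒reading ((y<τ ∷ inc) , (p<y ∷ p<τ)) =
  reading-max p<y (rising⇒reading (inc , All.zipWith (λ (p<d , y<d) → All.++⁺ p<d (y<d ∷ [])) (p<τ , y<τ)))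

reading⇒rising : ∀ {p τ} → Reading 0 p τ → RisingTail p τ
reading⇒rising reading-[] = [] , []
reading⇒rising {p} (reading-max p<y rest) with reading⇒rising rest
... | inc , py<τ = (All.map (λ py<d → All.head (All.++⁻ʳ p py<d)) py<τ ∷ inc) , (p<y ∷ All.map (All.++⁻ˡ p) py<τ)

alternating-reading : ∀ {ρ} → Alternating ρ → ∀ {K τ} → Reading K ρ τ →
  Σ ℕ λ K' → Reading K' [] (ρ ++ τ) × 2 * K' ≡ 2 * K + length ρ
alternating-reading alt-[] {K} rd = K , rd , sym (+-identityʳ _)
alternating-reading (alt-snoc {ρ} {a} {b} alt ρ<a b<a) {K} {τ} rd
  with alternating-reading alt (reading-pair ρ<a b<a rd)
... | K' , rd' , count = K' , subst (Reading K' []) (sym (++-assoc ρ (a ∷ b ∷ []) τ)) rd' , count'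
  where
  count' : 2 * K' ≡ 2 * K + length (ρ ++ a ∷ b ∷ [])
  count' = trans count (trans (regroup K (length ρ)) (cong (2 * K +_) (sym (length-++ ρ))))
    where
    regroup : ∀ k l → 2 * suc k + l ≡ 2 * k + (l + 2)
    regroup = solve-∀

reading⇒shape : ∀ {n t K p π} → Reading K p π → Alternating p → length p + 2 * K + t ≡ n → Shape n t (p ++ π)
reading⇒shape {n} {t} {p = p} {π} reading-[] alt len =
  shape p [] refl alt (trans (cong (_+ t) (sym (+-identityʳ (length p)))) len) ([] , [])
reading⇒shape {n} {t} {p = p} rd@(reading-max _ _) alt len =
  shape p _ refl alt (trans (cong (_+ t) (sym (+-identityʳ (length p)))) len) (reading⇒rising rd)
reading⇒shape {n} {t} {suc K} {p} (reading-pair {a = a} {b} {ρ} p<a b<a rest) alt len =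
  subst (Shape n t) (++-assoc p (a ∷ b ∷ []) ρ) (reading⇒shape rest (alt-snoc alt p<a b<a) len')
  where
  len' : length (p ++ a ∷ b ∷ []) + 2 * K + t ≡ n
  len' = trans (cong (λ l → l + 2 * K + t) (length-++ p)) (trans (cong (_+ t) (regroup (length p) K)) len)
    where
    regroup : ∀ l k → l + 2 + 2 * k ≡ l + 2 * suc k
    regroup = solve-∀

shape⟺pattern : ∀ n t K → 2 * K ≡ n ∸ t → t ≤ n → ∀ π → IsPerm n π → Shape n t π ⟺ LTRPattern n t π
shape⟺pattern n t K 2K≡n-t t≤n π π↭ = to , from
  where
  open PatternPositions n t K 2K≡n-t
  |π| : length π ≡ n
  |π| = trans (↭-length π↭) (range-length n)
  to : Shape n t π → LTRPattern n t π
  to (shape ρ τ split alt |ρ| rising) with alternating-reading alt (rising⇒reading rising)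
  ... | K' , rd , count = proj₂ (LTRPattern⟺LTRExactly n t π)
    (reading⇒exact K [] π 0 (subst₂ (λ k w → Reading k [] w) K'≡K (sym split) rd) refl refl |π|)
    where
    K'≡K : K' ≡ K
    K'≡K = *-cancelˡ-≡ K' K 2 (trans count (trans (sym (m+n∸n≡m (length ρ) t)) (trans (cong (_∸ t) |ρ|) (sym 2K≡n-t))))
  from : LTRPattern n t π → Shape n t π
  from pat = reading⇒shape
    (exact⇒reading K [] π 0 (proj₁ (LTRPattern⟺LTRExactly n t π) pat)
      (Unique-resp-↭ (↭-sym π↭) (range-unique n)) refl refl |π|)
    alt-[] (trans (cong (_+ t) 2K≡n-t) (m∸n+n≡m t≤n))

range′ : ℕ → List ℕ
range′ zero    = []
range′ (suc N) = range′ N ++ [ suc N ]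

range′≡range : ∀ N → range′ N ≡ range N
range′≡range zero    = refl
range′≡range (suc N) = trans (cong (_++ [ suc N ]) (range′≡range N))
  (trans (sym (map-++ suc (upTo N) [ N ])) (cong (map suc) (upTo-∷ʳ N)))

range′-length : ∀ N → length (range′ N) ≡ N
range′-length N = trans (cong length (range′≡range N)) (range-length N)

range′-unique : ∀ N → Unique (range′ N)
range′-unique N = subst Unique (sym (range′≡range N)) (range-unique N)

range′-bounds : ∀ N → All (λ x → 1 ≤ x × x ≤ N) (range′ N)
range′-bounds zero    = []
range′-bounds (suc N) = All.++⁺ (All.map (λ (1≤x , x≤N) → 1≤x , ≤-trans x≤N (n≤1+n N)) (range′-bounds N)) ((s≤s z≤n , ≤-refl) ∷ [])

∈-range′ : ∀ {x} N → 1 ≤ x → x ≤ N → x ∈ range′ N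
∈-range′ zero    (s≤s _) ()
∈-range′ {x} (suc N) 1≤x x≤ with m≤n⇒m<n∨m≡n x≤
... | inj₁ (s≤s x≤N) = ∈-++⁺ˡ (∈-range′ N 1≤x x≤N)
... | inj₂ refl      = ∈-++⁺ʳ (range′ N) (here refl)

range′-increasing : ∀ N → AllPairs _<_ (range′ N)
range′-increasing zero    = []
range′-increasing (suc N) = AllPairs.++⁺ (range′-increasing N) ([] ∷ []) (All.map (λ (_ , x≤N) → s≤s x≤N ∷ []) (range′-bounds N))

↭-range′-bounds : ∀ {N ρ} → ρ ↭ range′ N → All (λ x → 1 ≤ x × x ≤ N) ρ
↭-range′-bounds {N} p = All-resp-↭ (↭-sym p) (range′-bounds N)

-- Making room for a value v: v and everything above it move up by one; `shift-down` undoes it.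
shift-up : ℕ → ℕ → ℕ
shift-up v y = if y <ᵇ v then y else suc y

shift-down : ℕ → ℕ → ℕ
shift-down v y = if y <ᵇ v then y else pred y

shift-up-< : ∀ {v y} → y < v → shift-up v y ≡ y
shift-up-< y<v = if-true (<ᵇ-true y<v)

shift-up-≥ : ∀ {v y} → v ≤ y → shift-up v y ≡ suc y
shift-up-≥ v≤y = if-false (<ᵇ-false v≤y)

shift-down-< : ∀ {v y} → y < v → shift-down v y ≡ y
shift-down-< y<v = if-true (<ᵇ-true y<v)

shift-down-≥ : ∀ {v y} → v ≤ y → shift-down v y ≡ pred y
shift-down-≥ v≤y = if-false (<ᵇ-false v≤y)

shift-down-up : ∀ v y → shift-down v (shift-up v y) ≡ y
shift-down-up v y with y <? v
... | yes y<v = trans (cong (shift-down v) (shift-up-< y<v)) (shift-down-< y<v)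
... | no  y≮v = trans (cong (shift-down v) (shift-up-≥ (≮⇒≥ y≮v))) (shift-down-≥ (≤-trans (≮⇒≥ y≮v) (n≤1+n y)))

shift-up-down : ∀ v y → y ≢ v → shift-up v (shift-down v y) ≡ y
shift-up-down v y y≢v with y <? v
... | yes y<v = trans (cong (shift-up v) (shift-down-< y<v)) (shift-up-< y<v)
... | no  y≮v with ≤∧≢⇒< (≮⇒≥ y≮v) (y≢v ∘ sym)
...   | s≤s {_} {y'} v≤y' = trans (cong (shift-up v) (shift-down-≥ (≤-trans v≤y' (n≤1+n y')))) (shift-up-≥ v≤y')

shift-up-mono : ∀ v {x y} → x < y → shift-up v x < shift-up v y
shift-up-mono v {x} {y} x<y with x <? v | y <? v
... | yes x<v | yes y<v = subst₂ _<_ (sym (shift-up-< x<v)) (sym (shift-up-< y<v)) x<y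
... | yes x<v | no  y≮v = subst₂ _<_ (sym (shift-up-< x<v)) (sym (shift-up-≥ (≮⇒≥ y≮v))) (m<n⇒m<1+n x<y)
... | no  x≮v | yes y<v = ⊥-elim (x≮v (<-trans x<y y<v))
... | no  x≮v | no  y≮v = subst₂ _<_ (sym (shift-up-≥ (≮⇒≥ x≮v))) (sym (shift-up-≥ (≮⇒≥ y≮v))) (s≤s x<y)

shift-up-injective : ∀ v {x y} → shift-up v x ≡ shift-up v y → x ≡ y
shift-up-injective v {x} {y} e = trans (sym (shift-down-up v x)) (trans (cong (shift-down v) e) (shift-down-up v y))

shift-down-mono : ∀ v {x y} → x ≢ v → y ≢ v → x < y → shift-down v x < shift-down v y
shift-down-mono v {x} {y} x≢v y≢v x<y with <-cmp (shift-down v x) (shift-down v y)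
... | tri< lt _ _ = lt
... | tri≈ _ e _  = ⊥-elim (<-irrefl (trans (sym (shift-up-down v x x≢v)) (trans (cong (shift-up v) e) (shift-up-down v y y≢v))) x<y)
... | tri> _ _ gt = ⊥-elim (<-asym x<y (subst₂ _<_ (shift-up-down v y y≢v) (shift-up-down v x x≢v) (shift-up-mono v gt)))

shift-up-≤ : ∀ v y → shift-up v y ≤ suc y
shift-up-≤ v y with y <? v
... | yes y<v = ≤-trans (≤-reflexive (shift-up-< y<v)) (n≤1+n y)
... | no  y≮v = ≤-reflexive (shift-up-≥ (≮⇒≥ y≮v))

Alternating-map : ∀ {P : ℕ → Set} (f : ℕ → ℕ) → (∀ {x y} → P x → P y → x < y → f x < f y) →
  ∀ {ρ} → All P ρ → Alternating ρ → Alternating (map f ρ)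
Alternating-map f mono _ alt-[] = alt-[]
Alternating-map f mono {_} Pρab (alt-snoc {ρ} {a} {b} alt ρ<a b<a) with All.++⁻ ρ Pρab
... | Pρ , (Pa ∷ Pb ∷ []) = subst Alternating (sym (map-++ f ρ (a ∷ b ∷ [])))
  (alt-snoc (Alternating-map f mono Pρ alt) (All.map⁺ (All.zipWith (λ (Px , x<a) → mono Px Pa x<a) (Pρ , ρ<a))) (mono Pb Pa b<a))

swap-last : ∀ (A : List ℕ) x v → (A ++ [ x ]) ++ [ v ] ↭ (A ++ [ v ]) ++ [ x ]
swap-last A x v = ↭-trans (↭-reflexive (++-assoc A [ x ] [ v ]))
  (↭-trans (++⁺ˡ A (swap x v ↭-refl)) (↭-reflexive (sym (++-assoc A [ v ] [ x ]))))

shift-up-range′ : ∀ N v → 1 ≤ v → v ≤ suc N → map (shift-up v) (range′ N) ++ [ v ] ↭ range′ (suc N)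
shift-up-range′ zero    (suc zero)    _ _ = ↭-refl
shift-up-range′ zero    (suc (suc v)) _ (s≤s ())
shift-up-range′ (suc N) v 1≤v v≤ with m≤n⇒m<n∨m≡n v≤
... | inj₁ (s≤s v≤N+1) = ↭-trans (↭-reflexive (cong (_++ [ v ]) (trans (map-++ (shift-up v) (range′ N) [ suc N ])
        (cong (λ z → map (shift-up v) (range′ N) ++ [ z ]) (shift-up-≥ v≤N+1)))))
      (↭-trans (swap-last (map (shift-up v) (range′ N)) (suc (suc N)) v) (++⁺ʳ [ suc (suc N) ] (shift-up-range′ N v 1≤v v≤N+1)))
... | inj₂ refl = ↭-reflexive (cong (_++ [ suc (suc N) ])
      (map-id-local (All.map (λ (_ , x≤) → shift-up-< (s≤s x≤)) (range′-bounds (suc N)))))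

-- A new last pair for an alternating permutation σ of [2k]: the new maximum, then the valley v,
-- after shifting σ to make room for v.
extend : ℕ → ℕ → List ℕ → List ℕ
extend k v σ = map (shift-up v) σ ++ suc (suc (2 * k)) ∷ v ∷ []

extend-snoc : ∀ k v σ → extend k v σ ≡ (map (shift-up v) σ ++ [ suc (suc (2 * k)) ]) ++ [ v ]
extend-snoc k v σ = sym (++-assoc (map (shift-up v) σ) [ suc (suc (2 * k)) ] [ v ])

-- All alternating permutations of [2k], listed by the valley of the last pair.
alternating-perms : ℕ → List (List ℕ)
alternating-perms zero    = [] ∷ []
alternating-perms (suc k) = cartesianProductWith (extend k) (range′ (suc (2 * k))) (alternating-perms k)

extend-sound : ∀ k v σ → v ∈ range′ (suc (2 * k)) → σ ↭ range′ (2 * k) → Alternating σ →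
  extend k v σ ↭ range′ (2 * suc k) × Alternating (extend k v σ)
extend-sound k v σ v∈ σ↭ alt = perm , alt-snoc (Alternating-map {λ _ → ⊤} (shift-up v) (λ _ _ → shift-up-mono v)
  (All.universal _ σ) alt) shifted<top (s≤s v≤)
  where
  top : ℕ
  top = suc (suc (2 * k))
  v≤ : v ≤ suc (2 * k)
  v≤ = proj₂ (All.lookup (range′-bounds (suc (2 * k))) v∈)
  shifted<top : All (_< top) (map (shift-up v) σ)
  shifted<top = All.map⁺ (All.map (λ {y} (_ , y≤) → s≤s (≤-trans (shift-up-≤ v y) (s≤s y≤))) (↭-range′-bounds σ↭))
  perm : extend k v σ ↭ range′ (2 * suc k)
  perm = ↭-trans (↭-reflexive (extend-snoc k v σ))
    (↭-trans (swap-last (map (shift-up v) σ) top v)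
      (↭-trans (++⁺ʳ [ top ] (↭-trans (++⁺ʳ [ v ] (↭-map⁺ (shift-up v) σ↭))
        (shift-up-range′ (2 * k) v (proj₁ (All.lookup (range′-bounds (suc (2 * k))) v∈)) v≤)))
        (↭-reflexive (cong range′ (sym (double-suc k))))))

alternating-perms-sound : ∀ k ρ → ρ ∈ alternating-perms k → ρ ↭ range′ (2 * k) × Alternating ρ
alternating-perms-sound zero    ρ (here refl) = ↭-refl , alt-[]
alternating-perms-sound (suc k) ρ ρ∈ with ∈-cartesianProductWith⁻ (extend k) (range′ (suc (2 * k))) (alternating-perms k) ρ∈
... | v , σ , v∈ , σ∈ , refl = uncurry (extend-sound k v σ v∈) (alternating-perms-sound k σ σ∈)

largest-is-top : ∀ N {w a} → w ↭ range′ (suc N) → a ∈ w → All (_≤ a) w → a ≡ suc N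
largest-is-top N w↭ a∈w w≤a = ≤-antisym (proj₂ (All.lookup (↭-range′-bounds w↭) a∈w))
  (All.lookup w≤a (∈-resp-↭ (↭-sym w↭) (∈-++⁺ʳ (range′ N) (here refl))))

record Peeled (k : ℕ) (ρ : List ℕ) (b : ℕ) : Set where
  constructor peeled
  field
    valley∈ : b ∈ range′ (suc (2 * k))
    rest-↭ : map (shift-down b) ρ ↭ range′ (2 * k)
    rest-alternating : Alternating (map (shift-down b) ρ)
    rebuild : map (shift-up b) (map (shift-down b) ρ) ≡ ρ

-- The valley b is not the top (distinctness), so b ≤ 2k + 1; dropping b and the top from [2k + 2]
-- leaves [2k] shifted up past b, which `shift-down` brings back.
peel : ∀ k ρ b → ρ ++ suc (suc (2 * k)) ∷ b ∷ [] ↭ range′ (suc (suc (2 * k))) → Alternating ρ → Peeled k ρ b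
peel k ρ b ρtb↭ alt = peeled (∈-range′ (suc (2 * k)) 1≤b b≤) rest↭ rest-alt rebuild
  where
  top : ℕ
  top = suc (suc (2 * k))
  bounds : All (λ x → 1 ≤ x × x ≤ top) (ρ ++ top ∷ b ∷ [])
  bounds = ↭-range′-bounds ρtb↭
  1≤b : 1 ≤ b
  1≤b = proj₁ (All.lookup bounds (∈-++⁺ʳ ρ (there (here refl))))
  b<top : b < top
  b<top with All.lookup bounds (∈-++⁺ʳ ρ (there (here refl))) | Unique-resp-↭ (↭-sym ρtb↭) (range′-unique top)
  ... | _ , b≤top | u with AllPairs-++⁻ ρ u
  ...   | _ , ((top≢b ∷ []) ∷ _) , _ = ≤∧≢⇒< b≤top (top≢b ∘ sym)
  b≤ : b ≤ suc (2 * k)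
  b≤ = s≤s⁻¹ b<top
  ρb↭ : ρ ++ [ b ] ↭ range′ (suc (2 * k))
  ρb↭ = ↭-trans (drop-mid ρ (range′ (suc (2 * k))) {[ b ]} {[]} ρtb↭) (↭-reflexive (++-identityʳ _))
  ρ↭ : ρ ↭ map (shift-up b) (range′ (2 * k))
  ρ↭ = ↭-trans (↭-reflexive (sym (++-identityʳ ρ))) (↭-trans
    (drop-mid ρ (map (shift-up b) (range′ (2 * k))) {[]} {[]} (↭-trans ρb↭ (↭-sym (shift-up-range′ (2 * k) b 1≤b b≤))))
    (↭-reflexive (++-identityʳ _)))
  ρ≢b : All (_≢ b) ρ
  ρ≢b with AllPairs-++⁻ ρ (Unique-resp-↭ (↭-sym ρtb↭) (range′-unique top))
  ... | _ , _ , cross = All.map (λ x≢ → All.head (All.tail x≢)) cross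
  rest↭ : map (shift-down b) ρ ↭ range′ (2 * k)
  rest↭ = ↭-trans (↭-map⁺ (shift-down b) ρ↭) (↭-reflexive (trans (sym (map-∘ (range′ (2 * k))))
    (trans (map-cong (shift-down-up b) (range′ (2 * k))) (map-id (range′ (2 * k))))))
  rest-alt : Alternating (map (shift-down b) ρ)
  rest-alt = Alternating-map (shift-down b) (shift-down-mono b) ρ≢b alt
  rebuild : map (shift-up b) (map (shift-down b) ρ) ≡ ρ
  rebuild = trans (sym (map-∘ ρ)) (map-id-local (All.map (shift-up-down b _) ρ≢b))

-- ... and every alternating permutation of [2k] is listed: its last peak is the top 2k + 2.
alternating-perms-complete : ∀ k ρ → ρ ↭ range′ (2 * k) → Alternating ρ → ρ ∈ alternating-perms k
alternating-perms-complete zero    ρ  ρ↭ _      = subst (_∈ [] ∷ []) (sym (↭-empty-inv ρ↭)) (here refl)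
alternating-perms-complete (suc k) _  ρ↭ alt-[] =
  ⊥-elim (0≢1+n (trans (↭-length ρ↭) (trans (range′-length (2 * suc k)) (double-suc k))))
alternating-perms-complete (suc k) _  ρ↭ (alt-snoc {ρ} {a} {b} alt ρ<a b<a)
  with ρ↭′ ← ↭-trans ρ↭ (↭-reflexive (cong range′ (double-suc k)))
  with largest-is-top (suc (2 * k)) ρ↭′ (∈-insert ρ) (All.++⁺ (All.map <⇒≤ ρ<a) (≤-refl ∷ <⇒≤ b<a ∷ []))
... | refl with peel k ρ b ρ↭′ alt
... | peeled b∈ rest↭ rest-alt rebuild = subst (_∈ alternating-perms (suc k)) (cong (_++ a ∷ b ∷ []) rebuild)
  (∈-cartesianProductWith⁺ (extend k) b∈ (alternating-perms-complete k (map (shift-down b) ρ) rest↭ rest-alt))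

-- `extend k` is injective in both arguments: the valley is the last entry, and the rest is
-- recovered since `shift-up v` is injective.
extend-injective : ∀ k {v w σ τ} → extend k v σ ≡ extend k w τ → v ≡ w × σ ≡ τ
extend-injective k {v} {w} {σ} {τ} e
  with ∷ʳ-injective (map (shift-up v) σ ++ [ suc (suc (2 * k)) ]) (map (shift-up w) τ ++ [ suc (suc (2 * k)) ])
         (trans (sym (extend-snoc k v σ)) (trans e (extend-snoc k w τ)))
... | front≡ , refl = refl ,
  map-injective (shift-up-injective v) (proj₁ (∷ʳ-injective (map (shift-up v) σ) (map (shift-up v) τ) front≡))

alternating-perms-unique : ∀ k → Unique (alternating-perms k)
alternating-perms-unique zero    = [] ∷ []
alternating-perms-unique (suc k) =
  Unique.cartesianProductWith⁺ (extend k) (extend-injective k) (range′-unique (suc (2 * k))) (alternating-perms-unique k)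

length-cartesianProductWith : ∀ {A B C : Set} (f : A → B → C) xs ys →
  length (cartesianProductWith f xs ys) ≡ length xs * length ys
length-cartesianProductWith f []       ys = refl
length-cartesianProductWith f (x ∷ xs) ys =
  trans (length-++ (map (f x) ys)) (cong₂ _+_ (length-map (f x) ys) (length-cartesianProductWith f xs ys))

alternating-perms-length : ∀ k → length (alternating-perms k) ≡ (2 * k ∸ 1) !!
alternating-perms-length zero    = refl
alternating-perms-length (suc k) = begin
  length (alternating-perms (suc k))          ≡⟨ length-cartesianProductWith (extend k) (range′ (suc (2 * k))) _ ⟩
  length (range′ (suc (2 * k))) * length (alternating-perms k)
                                              ≡⟨ cong₂ _*_ (range′-length (suc (2 * k))) (alternating-perms-length k) ⟩
  suc (2 * k) * ((2 * k ∸ 1) !!)              ≡⟨ double-factorial-step (2 * k) ⟩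
  suc (2 * k) !!                              ≡⟨ cong (λ m → (m ∸ 1) !!) (sym (double-suc k)) ⟩
  (2 * suc k ∸ 1) !!                          ∎
  where
  open ≡-Reasoning
  double-factorial-step : ∀ m → suc m * ((m ∸ 1) !!) ≡ suc m !!
  double-factorial-step zero    = refl
  double-factorial-step (suc m) = refl

top-values : ℕ → ℕ → List ℕ
top-values a b = map (a +_) (range′ b)

top-values-suc : ∀ a b → top-values a (suc b) ≡ top-values a b ++ [ suc (a + b) ]
top-values-suc a b = trans (map-++ (a +_) (range′ b) [ suc b ]) (cong (λ x → top-values a b ++ [ x ]) (+-suc a b))

range′-split : ∀ a b → range′ (a + b) ≡ range′ a ++ top-values a b
range′-split a zero    = trans (cong range′ (+-identityʳ a)) (sym (++-identityʳ _))
range′-split a (suc b) = begin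
  range′ (a + suc b)                              ≡⟨ cong range′ (+-suc a b) ⟩
  range′ (a + b) ++ [ suc (a + b) ]               ≡⟨ cong (_++ [ suc (a + b) ]) (range′-split a b) ⟩
  (range′ a ++ top-values a b) ++ [ suc (a + b) ] ≡⟨ ++-assoc (range′ a) (top-values a b) _ ⟩
  range′ a ++ (top-values a b ++ [ suc (a + b) ]) ≡⟨ cong (range′ a ++_) (sym (top-values-suc a b)) ⟩
  range′ a ++ top-values a (suc b)                ∎
  where open ≡-Reasoning

top-values-rising : ∀ a b {xs} → All (_≤ a) xs → RisingTail xs (top-values a b)
top-values-rising a b xs≤a =
  AllPairs.map⁺ (AllPairs-map (+-monoʳ-< a) (range′-increasing b)) ,
  All.map⁺ (All.map (λ (1≤i , _) → All.map (λ x≤a → ≤-<-trans x≤a (m<m+n a 1≤i)) xs≤a) (range′-bounds b))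

rising-tail-is-top : ∀ a xs {ys} → Reverse ys → xs ++ ys ↭ range′ (a + length ys) → RisingTail xs ys →
  ys ≡ top-values a (length ys) × xs ↭ range′ a
rising-tail-is-top a xs [] xs↭ _ =
  refl , ↭-trans (↭-reflexive (sym (++-identityʳ xs))) (subst (λ N → xs ++ [] ↭ range′ N) (+-identityʳ a) xs↭)
rising-tail-is-top a xs (ys ∶ rs ∶ʳ m) xsysm↭ (inc , above)
  with AllPairs-++⁻ ys inc | All.++⁻ ys above
... | inc-ys , _ , ys<m | above-ys , (xs<m ∷ []) = ys≡ , proj₂ IH
  where
  b : ℕ
  b = length ys
  |ysm| : length (ys ++ [ m ]) ≡ suc b
  |ysm| = trans (length-++ ys) (+-comm b 1)
  xsysm↭′ : (xs ++ ys) ++ [ m ] ↭ range′ (suc (a + b))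
  xsysm↭′ = ↭-trans (↭-reflexive (++-assoc xs ys [ m ]))
    (subst (λ N → xs ++ ys ++ [ m ] ↭ range′ N) (trans (cong (a +_) |ysm|) (+-suc a b)) xsysm↭)
  m≡ : m ≡ suc (a + b)
  m≡ = largest-is-top (a + b) xsysm↭′ (∈-++⁺ʳ (xs ++ ys) (here refl))
    (All.++⁺ (All.++⁺ (All.map <⇒≤ xs<m) (All.map (<⇒≤ ∘ All.head) ys<m)) (≤-refl ∷ []))
  xsys↭ : xs ++ ys ↭ range′ (a + b)
  xsys↭ = ↭-trans (↭-reflexive (sym (++-identityʳ _))) (↭-trans
    (drop-mid (xs ++ ys) (range′ (a + b)) {[]} {[]} (subst (λ x → (xs ++ ys) ++ [ x ] ↭ range′ (suc (a + b))) m≡ xsysm↭′))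
    (↭-reflexive (++-identityʳ _)))
  IH : ys ≡ top-values a b × xs ↭ range′ a
  IH = rising-tail-is-top a xs rs xsys↭ (inc-ys , above-ys)
  ys≡ : ys ++ [ m ] ≡ top-values a (length (ys ++ [ m ]))
  ys≡ = trans (cong₂ (λ u x → u ++ [ x ]) (proj₁ IH) m≡) (trans (sym (top-values-suc a b)) (cong (top-values a) (sym |ysm|)))

parity-cancel : ∀ r s → r < 2 → s < 2 → (r + s) % 2 ≡ s → r ≡ 0
parity-cancel zero          _             _               _               _  = refl
parity-cancel (suc zero)    zero          _               _               ()
parity-cancel (suc zero)    (suc zero)    _               _               ()
parity-cancel (suc (suc _)) _             (s≤s (s≤s ()))  _               _
parity-cancel (suc zero)    (suc (suc _)) _               (s≤s (s≤s ()))  _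

even-difference : ∀ n t → t ≤ n → n % 2 ≡ t % 2 → 2 * ((n ∸ t) / 2) ≡ n ∸ t
even-difference n t t≤n parity = m*[n/m]≡n (m%n≡0⇒n∣m (n ∸ t) 2 (parity-cancel ((n ∸ t) % 2) (t % 2) (m%n<n (n ∸ t) 2) (m%n<n t 2)
  (trans (sym (%-distribˡ-+ (n ∸ t) t 2)) (trans (cong (_% 2) (m∸n+n≡m t≤n)) parity))))

shaped-perms : ℕ → ℕ → ℕ → List (List ℕ)
shaped-perms n t K = map (_++ top-values (n ∸ t) t) (alternating-perms K)

-- The list contains exactly the shaped permutations of [n]: by `rising-tail-is-top` the back of
-- a shape is the top t values, and the front an alternating permutation of [n − t].
shaped-perms-sound-complete : ∀ n t K → 2 * K ≡ n ∸ t → t ≤ n → ∀ π →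
  π ∈ shaped-perms n t K ⟺ (IsPerm n π × Shape n t π)
shaped-perms-sound-complete n t K 2K≡n-t t≤n π = to , from
  where
  top : List ℕ
  top = top-values (n ∸ t) t
  range′-n : range′ ((n ∸ t) + t) ≡ range n
  range′-n = trans (cong range′ (m∸n+n≡m t≤n)) (range′≡range n)
  to : π ∈ shaped-perms n t K → IsPerm n π × Shape n t π
  to π∈ with ∈-map⁻ (_++ top) π∈
  ... | ρ , ρ∈ , refl with alternating-perms-sound K ρ ρ∈
  ... | ρ↭ , alt = perm , shape ρ top refl alt |ρ| (top-values-rising (n ∸ t) t (All.map proj₂ (↭-range′-bounds ρ↭′)))
    where
    ρ↭′ : ρ ↭ range′ (n ∸ t)
    ρ↭′ = subst (λ N → ρ ↭ range′ N) 2K≡n-t ρ↭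
    perm : ρ ++ top ↭ range n
    perm = ↭-trans (++⁺ʳ top ρ↭′) (↭-reflexive (trans (sym (range′-split (n ∸ t) t)) range′-n))
    |ρ| : length ρ + t ≡ n
    |ρ| = trans (cong (_+ t) (trans (↭-length ρ↭′) (range′-length (n ∸ t)))) (m∸n+n≡m t≤n)
  from : IsPerm n π × Shape n t π → π ∈ shaped-perms n t K
  from (π↭ , sh@(shape ρ τ split alt |ρ| rising)) = subst (_∈ shaped-perms n t K) (sym π≡) (∈-map⁺ (_++ top) ρ∈)
    where
    |τ| : length τ ≡ t
    |τ| = Shape-back-length π↭ sh
    top-split : τ ≡ top-values (n ∸ t) (length τ) × ρ ↭ range′ (n ∸ t)
    top-split = rising-tail-is-top (n ∸ t) ρ (reverseView τ)
      (subst (_↭ range′ ((n ∸ t) + length τ)) split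
        (↭-trans π↭ (↭-reflexive (sym (trans (cong (λ l → range′ ((n ∸ t) + l)) |τ|) range′-n))))) rising
    π≡ : π ≡ ρ ++ top
    π≡ = trans split (cong (ρ ++_) (trans (proj₁ top-split) (cong (top-values (n ∸ t)) |τ|)))
    ρ∈ : ρ ∈ alternating-perms K
    ρ∈ = alternating-perms-complete K ρ (subst (λ N → ρ ↭ range′ N) (sym 2K≡n-t) (proj₂ top-split)) alt

theorem3 : (n t : ℕ) → 2 ≤ t → t ≤ n → n % 2 ≡ t % 2 →
    ((π : List ℕ) → IsPerm n π →
      ((TSorted t π × des π ≡ (n ∸ t) / 2) → LTRPattern n t π)
      × (LTRPattern n t π → (TSorted t π × des π ≡ (n ∸ t) / 2)))
    × (∃[ L ] (Unique L × length L ≡ (n ∸ t ∸ 1) !!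
        × ((π : List ℕ) → (π ∈ L → IsPerm n π × TSorted t π × des π ≡ (n ∸ t) / 2)
                        × (IsPerm n π × TSorted t π × des π ≡ (n ∸ t) / 2 → π ∈ L))))
theorem3 n t 2≤t t≤n parity = characterisation , shaped-perms n t K , unique , count , membership
  where
  K : ℕ
  K = (n ∸ t) / 2
  2K≡n-t : 2 * K ≡ n ∸ t
  2K≡n-t = even-difference n t t≤n parity
  extremal⟺shape : ∀ π → IsPerm n π → (TSorted t π × des π ≡ K) ⟺ Shape n t π
  extremal⟺shape π π↭ =
    (λ (sorted , d≡K) → shape-of-extremal n t π 2≤t t≤n π↭ sorted (trans (cong (2 *_) d≡K) 2K≡n-t)) ,
    (λ sh → let (sorted , 2d≡n-t) = extremal-of-shape n t π π↭ sh in sorted , *-cancelˡ-≡ _ K 2 (trans 2d≡n-t (sym 2K≡n-t)))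
  characterisation : ∀ π → IsPerm n π → (TSorted t π × des π ≡ K) ⟺ LTRPattern n t π
  characterisation π π↭ = ⟺-trans (extremal⟺shape π π↭) (shape⟺pattern n t K 2K≡n-t t≤n π π↭)
  unique : Unique (shaped-perms n t K)
  unique = Unique.map⁺ (++-cancelʳ _ _ _) (alternating-perms-unique K)
  count : length (shaped-perms n t K) ≡ (n ∸ t ∸ 1) !!
  count = trans (length-map _ (alternating-perms K)) (trans (alternating-perms-length K) (cong (λ m → (m ∸ 1) !!) 2K≡n-t))
  membership : ∀ π → (π ∈ shaped-perms n t K → IsPerm n π × TSorted t π × des π ≡ K)
                   × (IsPerm n π × TSorted t π × des π ≡ K → π ∈ shaped-perms n t K)
  membership π = (λ π∈ → let (π↭ , sh) = proj₁ listed π∈ in π↭ , proj₂ (extremal⟺shape π π↭) sh) ,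
                 (λ (π↭ , extremal) → proj₂ listed (π↭ , proj₁ (extremal⟺shape π π↭) extremal))
    where
    listed : π ∈ shaped-perms n t K ⟺ (IsPerm n π × Shape n t π)
    listed = shaped-perms-sound-complete n t K 2K≡n-t t≤n π
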